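{- For partitions $\lambda,\tau,\mu$, let $\mathcal F^\mu_{\lambda,\tau}$ be the set of fillings of some of the rows of the Young diagram of $\mu$, where every cell of a filled row receives the same label, using labels $i$ (for $1\le i\le\ell(\lambda)$) exactly $\lambda_i$ times and primed labels $j'$ (for $1\le j\le\ell(\tau)$) exactly $\tau_j$ times. For $F\in\mathcal F^\mu_{\lambda,\tau}$ let $wt(F)=(-1)^{a+b}$, where $a$ is the number of cells filled with primed labels and $b$ is the number of rows occupied by primed labels. Then $$\langle p_\mu,\,h_{|\mu|-|\lambda|-|\tau|}\,h_\lambda\,e_\tau\rangle=\sum_{F\in\mathcal F^\mu_{\lambda,\tau}}wt(F).$$
   Context: $Sym=\mathbb{Q}[p_1,p_2,\dots]$ with power sums $p_k$, complete homogeneous $h_k$ ($h_0=1$, $h_{ -r}=0$ for $r>0$), elementary $e_k$; $h_\lambda=\prod_ih_{\lambda_i}$, $e_\tau=\prod_je_{\tau_j}$. Hall inner product $\langle p_\lambda,p_\mu\rangle=z_\lambda\delta_{\lambda\mu}$, $z_\lambda=\prod_i i^{m_i(\lambda)}m_i(\lambda)!$. Rows of the diagram of $\mu$ are distinguishable (row $i$ has $\mu_i$ cells). -}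

module Defs where

open import Data.Bool using (Bool; true; false; if_then_else_)
open import Data.Nat as ℕ using (ℕ; zero; suc; _≤ᵇ_; _^_; _<_; _≥_; _!)
open import Data.Nat.ListAction using (sum; product)
open import Data.Integer as ℤ using (ℤ; +_; -[1+_])
open import Data.Rational using (ℚ; 0ℚ; 1ℚ; _+_; _*_; _/_; -_)
open import Data.List using (List; []; _∷_; _++_; map; concat; concatMap; foldr; upTo; filter; length; allFin)
open import Data.List.Properties using (≡-dec)
open import Data.List.Relation.Unary.All using (All)
open import Data.List.Relation.Unary.Linked using (Linked)
open import Data.Product using (_×_; _,_)
open import Data.Sum using (_⊎_; inj₁; inj₂)
open import Data.Maybe using (Maybe; just; nothing)
open import Data.Fin as Fin using (Fin)
open import Data.Fin.Properties using (all?)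
open import Data.Vec as Vec using (Vec; fromList; lookup)
open import Relation.Nullary using (Dec; yes; no)
open import Relation.Nullary.Decidable using (⌊_⌋; _×-dec_)
open import Relation.Binary.PropositionalEquality using (_≡_)

IsPartition : List ℕ → Set
IsPartition xs = All (λ k → 0 < k) xs × Linked _≥_ xs

∣_∣ : List ℕ → ℕ
∣ xs ∣ = sum xs

-- Sym = ℚ[p₁,p₂,…].  An element is a formal ℚ-linear combination of
-- monomials p_ν = p_{ν₁} p_{ν₂} ⋯, a monomial being stored as the
-- weakly decreasing list ν of its indices (all ≥ 1).

Mono : Set
Mono = List ℕ

Sym : Set
Sym = List (ℚ × Mono)

insertD : ℕ → Mono → Mono
insertD k [] = k ∷ []
insertD k (x ∷ xs) = if x ≤ᵇ k then k ∷ x ∷ xs else x ∷ insertD k xs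

_·ₘ_ : Mono → Mono → Mono
a ·ₘ b = foldr insertD b a

0S : Sym
0S = []

1S : Sym
1S = (1ℚ , []) ∷ []

_⊕_ : Sym → Sym → Sym
f ⊕ g = f ++ g

scale : ℚ → Sym → Sym
scale c = map (λ { (a , m) → (c * a , m) })

_⊗_ : Sym → Sym → Sym
f ⊗ g = concatMap (λ { (a , m) → map (λ { (b , n) → (a * b , m ·ₘ n) }) g }) f

p : ℕ → Sym
p k = (1ℚ , k ∷ []) ∷ []

pPart : List ℕ → Sym
pPart μ = foldr (λ k acc → p k ⊗ acc) 1S μ

fromℕℚ : ℕ → ℚ
fromℕℚ n = (+ n) / 1

lookupD : List Sym → ℕ → Sym
lookupD [] _ = 0S
lookupD (x ∷ xs) zero = x
lookupD (x ∷ xs) (suc i) = lookupD xs i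

negOnePow : ℕ → ℚ
negOnePow zero = 1ℚ
negOnePow (suc n) = - negOnePow n

-- hList k = [h_k, h_{k-1}, …, h_0], via Newton's identity
--   k h_k = Σ_{i=1}^k p_i h_{k-i}.
hList : ℕ → List Sym
hList zero = 1S ∷ []
hList (suc k) =
  scale ((+ 1) / suc k)
    (concat (map (λ i → p (suc i) ⊗ lookupD (hList k) i) (upTo (suc k))))
  ∷ hList k

-- eList k = [e_k, …, e_0], via Newton's identity
--   k e_k = Σ_{i=1}^k (-1)^{i-1} p_i e_{k-i}.
eList : ℕ → List Sym
eList zero = 1S ∷ []
eList (suc k) =
  scale ((+ 1) / suc k)
    (concat (map (λ i → scale (negOnePow i) (p (suc i) ⊗ lookupD (eList k) i)) (upTo (suc k))))
  ∷ eList k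

h : ℕ → Sym
h k = lookupD (hList k) 0

e : ℕ → Sym
e k = lookupD (eList k) 0

hℤ : ℤ → Sym
hℤ (+ n) = h n
hℤ -[1+ n ] = 0S

hPart : List ℕ → Sym
hPart la = foldr (λ k acc → h k ⊗ acc) 1S la

ePart : List ℕ → Sym
ePart ta = foldr (λ k acc → e k ⊗ acc) 1S ta

mult : ℕ → List ℕ → ℕ
mult i xs = length (filter (ℕ._≟ i) xs)

z : List ℕ → ℕ
z xs = product (map (λ i → (i ^ mult i xs) ℕ.* (mult i xs) !) (map suc (upTo (sum xs))))

sumℚ : List ℚ → ℚ
sumℚ = foldr _+_ 0ℚ

⟨_,_⟩ : Sym → Sym → ℚ
⟨ f , g ⟩ = sumℚ (concatMap (λ { (a , m) → map (λ { (b , n) →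
    if ⌊ ≡-dec ℕ._≟_ m n ⌋ then a * b * fromℕℚ (z m) else 0ℚ }) g }) f)

-- Rows of μ are indexed by Fin (length μ); row r has
-- lookup (fromList μ) r cells.  A filling assigns to each row either
-- nothing (row unfilled), an unprimed label i (inj₁ i, i : Fin ℓ(λ)),
-- or a primed label j' (inj₂ j, j : Fin ℓ(τ)); all cells of a filled
-- row carry that label.

Label : ℕ → ℕ → Set
Label a b = Maybe (Fin a ⊎ Fin b)

Filling : List ℕ → List ℕ → List ℕ → Set
Filling la ta mu = Vec (Label (length la) (length ta)) (length mu)

isU : ∀ {a b} → Fin a → Label a b → Bool
isU i (just (inj₁ i')) = ⌊ i Fin.≟ i' ⌋
isU i _ = false

isP : ∀ {a b} → Fin b → Label a b → Bool
isP j (just (inj₂ j')) = ⌊ j Fin.≟ j' ⌋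
isP j _ = false

isPrimed : ∀ {a b} → Label a b → Bool
isPrimed (just (inj₂ _)) = true
isPrimed _ = false

cellsWith : ∀ {A : Set} {n} → (A → Bool) → Vec ℕ n → Vec A n → ℕ
cellsWith q Vec.[] Vec.[] = 0
cellsWith q (c Vec.∷ cs) (x Vec.∷ xs) = (if q x then c else 0) ℕ.+ cellsWith q cs xs

rowsWith : ∀ {A : Set} {n} → (A → Bool) → Vec A n → ℕ
rowsWith q Vec.[] = 0
rowsWith q (x Vec.∷ xs) = (if q x then 1 else 0) ℕ.+ rowsWith q xs

Valid : (la ta mu : List ℕ) → Filling la ta mu → Set
Valid la ta mu F =
  ((i : Fin (length la)) → cellsWith (isU i) (fromList mu) F ≡ lookup (fromList la) i) ×
  ((j : Fin (length ta)) → cellsWith (isP j) (fromList mu) F ≡ lookup (fromList ta) j)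

valid? : (la ta mu : List ℕ) → (F : Filling la ta mu) → Dec (Valid la ta mu F)
valid? la ta mu F =
  all? (λ i → cellsWith (isU i) (fromList mu) F ℕ.≟ lookup (fromList la) i)
  ×-dec all? (λ j → cellsWith (isP j) (fromList mu) F ℕ.≟ lookup (fromList ta) j)

allLabels : ∀ a b → List (Label a b)
allLabels a b = nothing ∷ (map (λ i → just (inj₁ i)) (allFin a) ++ map (λ j → just (inj₂ j)) (allFin b))

allVecs : ∀ {A : Set} → List A → (n : ℕ) → List (Vec A n)
allVecs xs zero = Vec.[] ∷ []
allVecs xs (suc n) = concatMap (λ v → map (Vec._∷ v) xs) (allVecs xs n)

fillings : (la ta mu : List ℕ) → List (Filling la ta mu)
fillings la ta mu = filter (valid? la ta mu) (allVecs (allLabels (length la) (length ta)) (length mu))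

wt : (la ta mu : List ℕ) → Filling la ta mu → ℚ
wt la ta mu F = negOnePow (cellsWith isPrimed (fromList mu) F ℕ.+ rowsWith isPrimed F)

-- Pairing with p_k is adjoint to the
-- derivation k ∂/∂p_k, which sends h_n to h_{n-k} and e_n to (-1)^{k+1} e_{n-k} (by Newton's
-- identities ⟨p_r, h_n⟩ = [|r| = n] and ⟨p_r, e_n⟩ = (-1)^{|r|+ℓ(r)} [|r| = n]). Peeling the first
-- row k off μ therefore splits ⟨p_μ, h_N h_λ e_τ⟩ into three kinds of terms: k is taken from N,
-- from some λ_i, or from some τ_j with sign (-1)^{k+1}. The signed count of fillings obeys the same
-- recurrence, according to whether the first row is left empty, gets an unprimed label i or a
-- primed label j. For μ = ∅ both sides are [λ = 0, τ = 0] once N + |λ| + |τ| = |μ|. Along the way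
-- λ and τ become integer vectors, h and e of negative index being 0.

module Submission where

open import Defs
open import Data.List using (List; map)
open import Data.Nat using (ℕ)
open import Data.Integer using (+_; _-_)
open import Relation.Binary.PropositionalEquality

open import Algebra.Bundles using (CommutativeMonoid)
import Algebra.Properties.CommutativeSemigroup as CommSemigroupProperties
open import Data.Bool using (true; false; if_then_else_)
open import Data.Empty using (⊥-elim)
open import Data.Fin as Fin using (Fin)
open import Data.Fin.Properties using (all?)
open import Data.Integer as ℤ using (ℤ; -[1+_])
import Data.Integer.Properties as ℤ
open import Data.Integer.Tactic.RingSolver using () renaming (solve-∀ to ℤ-solve-∀)
open import Data.List as L using ([]; _∷_; _++_; concatMap; upTo; applyUpTo; filter; allFin; tabulate)
open import Data.List.Membership.Propositional using (_∈_)
open import Data.List.Properties using (filter-accept; filter-reject; upTo-∷ʳ; map-++; ++-identityʳ; ≡-dec)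
open import Data.List.Relation.Binary.Permutation.Propositional as ↭ using (_↭_; prep; swap; ↭-sym)
open import Data.List.Relation.Binary.Permutation.Propositional.Properties using (¬x∷xs↭[]; shift; ↭-length)
open import Data.List.Relation.Unary.All as All using (All; []; _∷_)
open import Data.List.Relation.Unary.All.Properties using (++⁺; map⁺)
open import Data.List.Relation.Unary.AllPairs using (_∷_)
open import Data.List.Relation.Unary.Any using (here; there)
open import Data.List.Relation.Unary.Linked as Linked using (Linked; []; [-]; _∷_)
open import Data.List.Relation.Unary.Linked.Properties using (Linked⇒AllPairs)
open import Data.Maybe using (just; nothing)
open import Data.Nat as ℕ using (zero; suc; _≤_; z≤n; s≤s; _^_; _!)
open import Data.Nat.Coprimality using (1-coprimeTo)
import Data.Nat.Coprimality as Coprime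
open import Data.Nat.ListAction using (sum; product)
open import Data.Nat.ListAction.Properties using (product-++; sum-↭)
import Data.Nat.Properties as ℕ
open import Data.Nat.Tactic.RingSolver using () renaming (solve-∀ to ℕ-solve-∀)
open import Data.Product as Product using (_×_; _,_; proj₂; map₁; map₂)
open import Data.Rational as ℚ using (ℚ; 0ℚ; 1ℚ; _+_; _*_; -_; mkℚ)
import Data.Rational.Properties as ℚ
open import Data.Rational.Solver using (module +-*-Solver)
open import Data.Sum using (inj₁; inj₂)
open import Data.Unit using (tt)
open import Data.Vec as V using (Vec; []; _∷_)
open import Data.Vec.Properties using (lookup∘updateAt; lookup∘updateAt′; lookup-map)
open import Function using (_∘_; id)
open import Relation.Binary.Core using (_Preserves_⟶_)
open import Relation.Binary.Definitions using (tri<; tri≈; tri>)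
open import Relation.Nullary using (Dec; yes; no; does; ¬_)
open import Relation.Nullary.Decidable using (_×-dec_; dec-false; ⌊_⌋)

open ≡-Reasoning
open +-*-Solver using (solve; _:*_; _:=_)

module ℚ+-Properties = CommSemigroupProperties (CommutativeMonoid.commutativeSemigroup ℚ.+-0-commutativeMonoid)
module ℚ*-Properties = CommSemigroupProperties (CommutativeMonoid.commutativeSemigroup ℚ.*-1-commutativeMonoid)
module ℕ*-Properties = CommSemigroupProperties (CommutativeMonoid.commutativeSemigroup ℕ.*-1-commutativeMonoid)

-- After rewriting with this normal form, ℚ's _+_ and _*_ compute on fromℕℚ.
fromℕℚ≡mkℚ : ∀ n → fromℕℚ n ≡ mkℚ (+ n) 0 (Coprime.sym (1-coprimeTo n))
fromℕℚ≡mkℚ n = ℚ.↥p/↧p≡p (mkℚ (+ n) 0 (Coprime.sym (1-coprimeTo n)))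

fromℕℚ-+ : ∀ m n → fromℕℚ (m ℕ.+ n) ≡ fromℕℚ m + fromℕℚ n
fromℕℚ-+ m n rewrite fromℕℚ≡mkℚ m | fromℕℚ≡mkℚ n =
  cong₂ (λ a b → (a ℤ.+ b) ℚ./ 1) (sym (ℤ.*-identityʳ (+ m))) (sym (ℤ.*-identityʳ (+ n)))

fromℕℚ-* : ∀ m n → fromℕℚ (m ℕ.* n) ≡ fromℕℚ m * fromℕℚ n
fromℕℚ-* m n rewrite fromℕℚ≡mkℚ m | fromℕℚ≡mkℚ n = cong (ℚ._/ 1) (sym (ℤ.+◃n≡+n (m ℕ.* n)))

1/suc*suc≡1 : ∀ k → ((+ 1) ℚ./ suc k) * fromℕℚ (suc k) ≡ 1ℚ
1/suc*suc≡1 k rewrite fromℕℚ≡mkℚ (suc k) =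
  trans (cong (_* mkℚ (+ suc k) 0 (Coprime.sym (1-coprimeTo (suc k)))) (ℚ.↥p/↧p≡p (mkℚ (+ 1) k (1-coprimeTo (suc k)))))
        (ℚ.*-inverseˡ (mkℚ (+ suc k) 0 (Coprime.sym (1-coprimeTo (suc k)))))

negOnePow-+ : ∀ m n → negOnePow (m ℕ.+ n) ≡ negOnePow m * negOnePow n
negOnePow-+ zero n = sym (ℚ.*-identityˡ _)
negOnePow-+ (suc m) n = trans (cong -_ (negOnePow-+ m n)) (ℚ.neg-distribˡ-* (negOnePow m) (negOnePow n))

negOnePow-2+ : ∀ n → negOnePow (2 ℕ.+ n) ≡ negOnePow n
negOnePow-2+ n = ⁻¹-involutive (negOnePow n)
  where open import Algebra.Properties.Group ℚ.+-0-group using (⁻¹-involutive)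

+[k+s]≡z⇒+s≡z-k : ∀ k s z → + (k ℕ.+ s) ≡ z → + s ≡ z - + k
+[k+s]≡z⇒+s≡z-k k s z refl = trans (cancel (+ k) (+ s)) (cong (_- + k) (sym (ℤ.pos-+ k s)))
  where
  cancel : ∀ a b → b ≡ a ℤ.+ b - a
  cancel = ℤ-solve-∀

+s≡z-k⇒+[k+s]≡z : ∀ k s z → + s ≡ z - + k → + (k ℕ.+ s) ≡ z
+s≡z-k⇒+[k+s]≡z k s z s≡z-k = trans (ℤ.pos-+ k s) (trans (cong (ℤ._+_ (+ k)) s≡z-k) (cancel (+ k) z))
  where
  cancel : ∀ a b → a ℤ.+ (b - a) ≡ b
  cancel = ℤ-solve-∀

private variable A B : Set

∑ : List A → (A → ℚ) → ℚ
∑ xs f = sumℚ (map f xs)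

∑-++ : ∀ (xs ys : List A) f → ∑ (xs ++ ys) f ≡ ∑ xs f + ∑ ys f
∑-++ [] ys f = sym (ℚ.+-identityˡ _)
∑-++ (x ∷ xs) ys f = trans (cong (_+_ (f x)) (∑-++ xs ys f)) (sym (ℚ.+-assoc (f x) _ _))

∑-map : ∀ (g : A → B) (xs : List A) f → ∑ (map g xs) f ≡ ∑ xs (λ x → f (g x))
∑-map g [] f = refl
∑-map g (x ∷ xs) f = cong (_+_ (f (g x))) (∑-map g xs f)

∑-concatMap : ∀ (g : A → List B) (xs : List A) f → ∑ (concatMap g xs) f ≡ ∑ xs (λ x → ∑ (g x) f)
∑-concatMap g [] f = refl
∑-concatMap g (x ∷ xs) f = trans (∑-++ (g x) (concatMap g xs) f) (cong (_+_ (∑ (g x) f)) (∑-concatMap g xs f))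

∑-cong : ∀ (xs : List A) {f g : A → ℚ} → (∀ x → f x ≡ g x) → ∑ xs f ≡ ∑ xs g
∑-cong [] f≡g = refl
∑-cong (x ∷ xs) f≡g = cong₂ _+_ (f≡g x) (∑-cong xs f≡g)

∑-cong-All : ∀ {P : A → Set} {xs : List A} {f g : A → ℚ} → All P xs → (∀ x → P x → f x ≡ g x) → ∑ xs f ≡ ∑ xs g
∑-cong-All [] f≡g = refl
∑-cong-All {xs = x ∷ _} (px ∷ pxs) f≡g = cong₂ _+_ (f≡g x px) (∑-cong-All pxs f≡g)

∑-zero : ∀ (xs : List A) → ∑ xs (λ _ → 0ℚ) ≡ 0ℚ
∑-zero [] = refl
∑-zero (x ∷ xs) = trans (ℚ.+-identityˡ _) (∑-zero xs)

∑-+ : ∀ (xs : List A) f g → ∑ xs (λ x → f x + g x) ≡ ∑ xs f + ∑ xs g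
∑-+ [] f g = refl
∑-+ (x ∷ xs) f g = trans (cong (_+_ (f x + g x)) (∑-+ xs f g)) (ℚ+-Properties.interchange (f x) (g x) (∑ xs f) (∑ xs g))

∑-*ˡ : ∀ (xs : List A) c f → ∑ xs (λ x → c * f x) ≡ c * ∑ xs f
∑-*ˡ [] c f = sym (ℚ.*-zeroʳ c)
∑-*ˡ (x ∷ xs) c f = trans (cong (_+_ (c * f x)) (∑-*ˡ xs c f)) (sym (ℚ.*-distribˡ-+ c (f x) (∑ xs f)))

∑-*ʳ : ∀ (xs : List A) c f → ∑ xs (λ x → f x * c) ≡ ∑ xs f * c
∑-*ʳ xs c f = trans (∑-cong xs (λ x → ℚ.*-comm (f x) c)) (trans (∑-*ˡ xs c f) (ℚ.*-comm c _))

∑-swap : ∀ (xs : List A) (ys : List B) (f : A → B → ℚ) →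
         ∑ xs (λ x → ∑ ys (f x)) ≡ ∑ ys (λ y → ∑ xs (λ x → f x y))
∑-swap [] ys f = sym (∑-zero ys)
∑-swap (x ∷ xs) ys f = trans (cong (_+_ (∑ ys (f x))) (∑-swap xs ys f)) (sym (∑-+ ys (f x) _))

∑*∑ : ∀ (xs : List A) (ys : List B) f g → ∑ xs f * ∑ ys g ≡ ∑ xs (λ x → ∑ ys (λ y → f x * g y))
∑*∑ xs ys f g = trans (sym (∑-*ʳ xs (∑ ys g) f)) (∑-cong xs (λ x → sym (∑-*ˡ ys (f x) g)))

𝟙 : Dec A → ℚ
𝟙 d = if does d then 1ℚ else 0ℚ

𝟙-cong : (a? : Dec A) (b? : Dec B) → (A → B) → (B → A) → 𝟙 a? ≡ 𝟙 b?
𝟙-cong (yes a) (yes b) f g = refl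
𝟙-cong (yes a) (no ¬b) f g = ⊥-elim (¬b (f a))
𝟙-cong (no ¬a) (yes b) f g = ⊥-elim (¬a (g b))
𝟙-cong (no ¬a) (no ¬b) f g = refl

𝟙-×-dec : (a? : Dec A) (b? : Dec B) → 𝟙 (a? ×-dec b?) ≡ 𝟙 a? * 𝟙 b?
𝟙-×-dec (yes a) (yes b) = refl
𝟙-×-dec (yes a) (no ¬b) = refl
𝟙-×-dec (no ¬a) (yes b) = refl
𝟙-×-dec (no ¬a) (no ¬b) = refl

𝟙-yes : ∀ (a? : Dec A) → A → 𝟙 a? ≡ 1ℚ
𝟙-yes (yes _) _ = refl
𝟙-yes (no ¬a) a = ⊥-elim (¬a a)

𝟙-no : ∀ (a? : Dec A) → ¬ A → 𝟙 a? ≡ 0ℚ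
𝟙-no (yes a) ¬a = ⊥-elim (¬a a)
𝟙-no (no _) _ = refl

∑-filter : ∀ {P : A → Set} (P? : ∀ x → Dec (P x)) (xs : List A) f →
           ∑ (filter P? xs) f ≡ ∑ xs (λ x → 𝟙 (P? x) * f x)
∑-filter P? [] f = refl
∑-filter P? (x ∷ xs) f with does (P? x)
... | true = cong₂ _+_ (sym (ℚ.*-identityˡ (f x))) (∑-filter P? xs f)
... | false = trans (∑-filter P? xs f) (sym (trans (cong (_+ _) (ℚ.*-zeroˡ (f x))) (ℚ.+-identityˡ _)))

∑-upTo-suc : ∀ n f → ∑ (upTo (suc n)) f ≡ f 0 + ∑ (upTo n) (λ i → f (suc i))
∑-upTo-suc n f = cong (_+_ (f 0)) (∑-applyUpTo n suc f)
  where
  ∑-applyUpTo : ∀ n (g : ℕ → ℕ) f → ∑ (applyUpTo g n) f ≡ ∑ (upTo n) (λ i → f (g i))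
  ∑-applyUpTo zero g f = refl
  ∑-applyUpTo (suc n) g f =
    cong (_+_ (f (g 0))) (trans (∑-applyUpTo n (λ i → g (suc i)) f) (sym (∑-applyUpTo n suc (λ i → f (g i)))))

∑-upTo-𝟙 : ∀ n s G → (n ≤ s → G s ≡ 0ℚ) → ∑ (upTo n) (λ i → 𝟙 (i ℕ.≟ s) * G i) ≡ G s
∑-upTo-𝟙 zero s G out = sym (out z≤n)
∑-upTo-𝟙 (suc n) zero G out = begin
  ∑ (upTo (suc n)) (λ i → 𝟙 (i ℕ.≟ 0) * G i)   ≡⟨ ∑-upTo-suc n (λ i → 𝟙 (i ℕ.≟ 0) * G i) ⟩
  1ℚ * G 0 + ∑ (upTo n) (λ i → 0ℚ * G (suc i)) ≡⟨ cong₂ _+_ (ℚ.*-identityˡ (G 0)) (trans (∑-cong (upTo n) (λ i → ℚ.*-zeroˡ (G (suc i)))) (∑-zero (upTo n))) ⟩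
  G 0 + 0ℚ                                      ≡⟨ ℚ.+-identityʳ (G 0) ⟩
  G 0                                           ∎
∑-upTo-𝟙 (suc n) (suc s) G out = begin
  ∑ (upTo (suc n)) (λ i → 𝟙 (i ℕ.≟ suc s) * G i)       ≡⟨ ∑-upTo-suc n (λ i → 𝟙 (i ℕ.≟ suc s) * G i) ⟩
  0ℚ * G 0 + ∑ (upTo n) (λ i → 𝟙 (i ℕ.≟ s) * G (suc i)) ≡⟨ cong (_+ ∑ (upTo n) (λ i → 𝟙 (i ℕ.≟ s) * G (suc i))) (ℚ.*-zeroˡ (G 0)) ⟩
  0ℚ + ∑ (upTo n) (λ i → 𝟙 (i ℕ.≟ s) * G (suc i))      ≡⟨ ℚ.+-identityˡ _ ⟩
  ∑ (upTo n) (λ i → 𝟙 (i ℕ.≟ s) * G (suc i))           ≡⟨ ∑-upTo-𝟙 n s (λ i → G (suc i)) (λ n≤s → out (s≤s n≤s)) ⟩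
  G (suc s)                                             ∎

∑-allFin-suc : ∀ n f → ∑ (allFin (suc n)) f ≡ f Fin.zero + ∑ (allFin n) (λ i → f (Fin.suc i))
∑-allFin-suc n f = cong (_+_ (f Fin.zero)) (∑-tabulate n Fin.suc f)
  where
  ∑-tabulate : ∀ n (g : Fin n → A) f → ∑ (tabulate g) f ≡ ∑ (allFin n) (λ i → f (g i))
  ∑-tabulate zero g f = refl
  ∑-tabulate (suc n) g f =
    cong (_+_ (f (g Fin.zero))) (trans (∑-tabulate n (λ i → g (Fin.suc i)) f) (sym (∑-tabulate n Fin.suc (λ i → f (g i)))))

∑-allVecs-suc : ∀ (xs : List A) n G → ∑ (allVecs xs (suc n)) G ≡ ∑ xs (λ x → ∑ (allVecs xs n) (λ v → G (x ∷ v)))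
∑-allVecs-suc xs n G = begin
  ∑ (concatMap (λ v → map (_∷ v) xs) (allVecs xs n)) G  ≡⟨ ∑-concatMap _ (allVecs xs n) G ⟩
  ∑ (allVecs xs n) (λ v → ∑ (map (_∷ v) xs) G)          ≡⟨ ∑-cong (allVecs xs n) (λ v → ∑-map (_∷ v) xs G) ⟩
  ∑ (allVecs xs n) (λ v → ∑ xs (λ x → G (x ∷ v)))       ≡⟨ ∑-swap (allVecs xs n) xs _ ⟩
  ∑ xs (λ x → ∑ (allVecs xs n) (λ v → G (x ∷ v)))       ∎

-- The pairing ⟨p_r, p_n⟩ of power-sum monomials

Positive : List ℕ → Set
Positive = All (0 ℕ.<_)

Decreasing : List ℕ → Set
Decreasing = Linked ℕ._≥_

removals : ℕ → Mono → List Mono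
removals k [] = []
removals k (x ∷ xs) = (if does (x ℕ.≟ k) then xs ∷ [] else []) ++ map (x ∷_) (removals k xs)

∑-removals-∷ : ∀ k x xs (F : Mono → ℚ) →
               ∑ (removals k (x ∷ xs)) F ≡ 𝟙 (x ℕ.≟ k) * F xs + ∑ (removals k xs) (λ d → F (x ∷ d))
∑-removals-∷ k x xs F with does (x ℕ.≟ k)
... | true = cong₂ _+_ (sym (ℚ.*-identityˡ (F xs))) (∑-map (x ∷_) (removals k xs) F)
... | false = begin
  ∑ (map (x ∷_) (removals k xs)) F              ≡⟨ ∑-map (x ∷_) (removals k xs) F ⟩
  ∑ (removals k xs) (λ d → F (x ∷ d))           ≡⟨ ℚ.+-identityˡ _ ⟨
  0ℚ + ∑ (removals k xs) (λ d → F (x ∷ d))      ≡⟨ cong (_+ ∑ (removals k xs) (λ d → F (x ∷ d))) (ℚ.*-zeroˡ (F xs)) ⟨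
  0ℚ * F xs + ∑ (removals k xs) (λ d → F (x ∷ d)) ∎

∑-removals-++ : ∀ k m n (F : Mono → ℚ) →
  ∑ (removals k (m ++ n)) F ≡ ∑ (removals k m) (λ d → F (d ++ n)) + ∑ (removals k n) (λ d → F (m ++ d))
∑-removals-++ k [] n F = sym (ℚ.+-identityˡ _)
∑-removals-++ k (x ∷ m) n F = begin
  ∑ (removals k (x ∷ m ++ n)) F
    ≡⟨ ∑-removals-∷ k x (m ++ n) F ⟩
  𝟙 (x ℕ.≟ k) * F (m ++ n) + ∑ (removals k (m ++ n)) (λ d → F (x ∷ d))
    ≡⟨ cong (_+_ (𝟙 (x ℕ.≟ k) * F (m ++ n))) (∑-removals-++ k m n (λ d → F (x ∷ d))) ⟩
  𝟙 (x ℕ.≟ k) * F (m ++ n) + (∑ (removals k m) (λ d → F (x ∷ d ++ n)) + ∑ (removals k n) (λ d → F (x ∷ m ++ d)))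
    ≡⟨ ℚ.+-assoc (𝟙 (x ℕ.≟ k) * F (m ++ n)) _ _ ⟨
  𝟙 (x ℕ.≟ k) * F (m ++ n) + ∑ (removals k m) (λ d → F (x ∷ d ++ n)) + ∑ (removals k n) (λ d → F (x ∷ m ++ d))
    ≡⟨ cong (_+ ∑ (removals k n) (λ d → F (x ∷ m ++ d))) (∑-removals-∷ k x m (λ d → F (d ++ n))) ⟨
  ∑ (removals k (x ∷ m)) (λ d → F (d ++ n)) + ∑ (removals k n) (λ d → F (x ∷ m ++ d))
    ∎

∑-removals-↭ : ∀ k (F : Mono → ℚ) → F Preserves _↭_ ⟶ _≡_ → (λ n → ∑ (removals k n) F) Preserves _↭_ ⟶ _≡_
∑-removals-↭ k F F-↭ ↭.refl = refl
∑-removals-↭ k F F-↭ (prep {xs} {ys} x p) = begin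
  ∑ (removals k (x ∷ xs)) F                                    ≡⟨ ∑-removals-∷ k x xs F ⟩
  𝟙 (x ℕ.≟ k) * F xs + ∑ (removals k xs) (λ d → F (x ∷ d))    ≡⟨ cong₂ (λ a b → 𝟙 (x ℕ.≟ k) * a + b) (F-↭ p)
                                                                    (∑-removals-↭ k (λ d → F (x ∷ d)) (F-↭ ∘ prep x) p) ⟩
  𝟙 (x ℕ.≟ k) * F ys + ∑ (removals k ys) (λ d → F (x ∷ d))    ≡⟨ ∑-removals-∷ k x ys F ⟨
  ∑ (removals k (x ∷ ys)) F                                    ∎
∑-removals-↭ k F F-↭ (swap {xs} {ys} x y p) = begin
  ∑ (removals k (x ∷ y ∷ xs)) F
    ≡⟨ ∑-removals-∷ k x (y ∷ xs) F ⟩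
  a (y ∷ xs) + ∑ (removals k (y ∷ xs)) (λ d → F (x ∷ d))
    ≡⟨ cong (_+_ (a (y ∷ xs))) (∑-removals-∷ k y xs (λ d → F (x ∷ d))) ⟩
  a (y ∷ xs) + (b (x ∷ xs) + ∑ (removals k xs) (λ d → F (x ∷ y ∷ d)))
    ≡⟨ cong₂ (λ u v → u + (v + _)) (cong (𝟙 (x ℕ.≟ k) *_) (F-↭ (prep y p))) (cong (𝟙 (y ℕ.≟ k) *_) (F-↭ (prep x p))) ⟩
  a (y ∷ ys) + (b (x ∷ ys) + ∑ (removals k xs) (λ d → F (x ∷ y ∷ d)))
    ≡⟨ cong (λ s → a (y ∷ ys) + (b (x ∷ ys) + s))
         (trans (∑-removals-↭ k (λ d → F (x ∷ y ∷ d)) (F-↭ ∘ prep x ∘ prep y) p)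
                (∑-cong (removals k ys) (λ d → F-↭ (swap x y ↭.refl)))) ⟩
  a (y ∷ ys) + (b (x ∷ ys) + ∑ (removals k ys) (λ d → F (y ∷ x ∷ d)))
    ≡⟨ ℚ+-Properties.x∙yz≈y∙xz (a (y ∷ ys)) (b (x ∷ ys)) _ ⟩
  b (x ∷ ys) + (a (y ∷ ys) + ∑ (removals k ys) (λ d → F (y ∷ x ∷ d)))
    ≡⟨ cong (_+_ (b (x ∷ ys))) (∑-removals-∷ k x ys (λ d → F (y ∷ d))) ⟨
  b (x ∷ ys) + ∑ (removals k (x ∷ ys)) (λ d → F (y ∷ d))
    ≡⟨ ∑-removals-∷ k y (x ∷ ys) F ⟨
  ∑ (removals k (y ∷ x ∷ ys)) F
    ∎
  where
  a b : Mono → ℚ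
  a n = 𝟙 (x ℕ.≟ k) * F n
  b n = 𝟙 (y ℕ.≟ k) * F n
∑-removals-↭ k F F-↭ (↭.trans p q) = trans (∑-removals-↭ k F F-↭ p) (∑-removals-↭ k F F-↭ q)

-- ⟪ r , n ⟫ₘ = ⟨p_r, p_n⟩ for an arbitrary list r: pairing with p_k is adjoint to k ∂/∂p_k.
⟪_,_⟫ₘ : List ℕ → Mono → ℚ
⟪ [] , [] ⟫ₘ = 1ℚ
⟪ [] , _ ∷ _ ⟫ₘ = 0ℚ
⟪ k ∷ r , n ⟫ₘ = fromℕℚ k * ∑ (removals k n) ⟪ r ,_⟫ₘ

⟪⟫ₘ-↭ : ∀ r → ⟪ r ,_⟫ₘ Preserves _↭_ ⟶ _≡_
⟪⟫ₘ-↭ [] {[]} {[]} p = refl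
⟪⟫ₘ-↭ [] {[]} {_ ∷ _} p = ⊥-elim (¬x∷xs↭[] (↭-sym p))
⟪⟫ₘ-↭ [] {_ ∷ _} {[]} p = ⊥-elim (¬x∷xs↭[] p)
⟪⟫ₘ-↭ [] {_ ∷ _} {_ ∷ _} p = refl
⟪⟫ₘ-↭ (k ∷ r) p = cong (fromℕℚ k *_) (∑-removals-↭ k ⟪ r ,_⟫ₘ (⟪⟫ₘ-↭ r) p)

insertD-↭ : ∀ k xs → insertD k xs ↭ k ∷ xs
insertD-↭ k [] = ↭.refl
insertD-↭ k (x ∷ xs) with x ℕ.≤ᵇ k
... | true = ↭.refl
... | false = ↭.trans (prep x (insertD-↭ k xs)) (swap x k ↭.refl)

·ₘ-↭ : ∀ m n → m ·ₘ n ↭ m ++ n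
·ₘ-↭ [] n = ↭.refl
·ₘ-↭ (x ∷ m) n = ↭.trans (insertD-↭ x (m ·ₘ n)) (prep x (·ₘ-↭ m n))

splittings : List ℕ → List (List ℕ × List ℕ)
splittings [] = ([] , []) ∷ []
splittings (k ∷ r) = map (map₁ (k ∷_)) (splittings r) ++ map (map₂ (k ∷_)) (splittings r)

∑-splittings-∷ : ∀ k r (G : List ℕ × List ℕ → ℚ) →
  ∑ (splittings (k ∷ r)) G ≡ ∑ (splittings r) (G ∘ map₁ (k ∷_)) + ∑ (splittings r) (G ∘ map₂ (k ∷_))
∑-splittings-∷ k r G = trans (∑-++ (map (map₁ (k ∷_)) (splittings r)) _ G)
  (cong₂ _+_ (∑-map (map₁ (k ∷_)) (splittings r) G) (∑-map (map₂ (k ∷_)) (splittings r) G))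

splittings-↭ : ∀ r → All (λ (S , T) → S ++ T ↭ r) (splittings r)
splittings-↭ [] = ↭.refl ∷ []
splittings-↭ (k ∷ r) =
  ++⁺ (map⁺ (All.map (prep k) (splittings-↭ r)))
      (map⁺ (All.map (λ {(S , T)} S++T↭r → ↭.trans (shift k S T) (prep k S++T↭r)) (splittings-↭ r)))

splittings-positive : ∀ {r} → Positive r → All (λ (S , T) → Positive S × Positive T) (splittings r)
splittings-positive [] = ([] , []) ∷ []
splittings-positive (k>0 ∷ r>0) =
  ++⁺ (map⁺ (All.map (map₁ (k>0 ∷_)) (splittings-positive r>0))) (map⁺ (All.map (map₂ (k>0 ∷_)) (splittings-positive r>0)))

⟪⟫ₘ-++ : ∀ r m n → ⟪ r , m ++ n ⟫ₘ ≡ ∑ (splittings r) (λ (S , T) → ⟪ S , m ⟫ₘ * ⟪ T , n ⟫ₘ)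
⟪⟫ₘ-++ [] [] n = sym (trans (ℚ.+-identityʳ _) (ℚ.*-identityˡ _))
⟪⟫ₘ-++ [] (_ ∷ _) n = sym (trans (ℚ.+-identityʳ _) (ℚ.*-zeroˡ ⟪ [] , n ⟫ₘ))
⟪⟫ₘ-++ (k ∷ r) m n = begin
  fromℕℚ k * ∑ (removals k (m ++ n)) ⟪ r ,_⟫ₘ
    ≡⟨ cong (κ *_) (∑-removals-++ k m n ⟪ r ,_⟫ₘ) ⟩
  κ * (∑ (removals k m) (λ d → ⟪ r , d ++ n ⟫ₘ) + ∑ (removals k n) (λ d → ⟪ r , m ++ d ⟫ₘ))
    ≡⟨ cong (κ *_) (cong₂ _+_ (∑-cong (removals k m) (λ d → ⟪⟫ₘ-++ r d n)) (∑-cong (removals k n) (⟪⟫ₘ-++ r m))) ⟩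
  κ * (∑ (removals k m) (λ d → ∑ (splittings r) (λ (S , T) → ⟪ S , d ⟫ₘ * ⟪ T , n ⟫ₘ))
       + ∑ (removals k n) (λ d → ∑ (splittings r) (λ (S , T) → ⟪ S , m ⟫ₘ * ⟪ T , d ⟫ₘ)))
    ≡⟨ cong (κ *_) (cong₂ _+_ (∑-swap (removals k m) (splittings r) _) (∑-swap (removals k n) (splittings r) _)) ⟩
  κ * (∑ (splittings r) (λ (S , T) → ∑ (removals k m) (λ d → ⟪ S , d ⟫ₘ * ⟪ T , n ⟫ₘ))
       + ∑ (splittings r) (λ (S , T) → ∑ (removals k n) (λ d → ⟪ S , m ⟫ₘ * ⟪ T , d ⟫ₘ)))
    ≡⟨ ℚ.*-distribˡ-+ κ _ _ ⟩
  κ * ∑ (splittings r) (λ (S , T) → ∑ (removals k m) (λ d → ⟪ S , d ⟫ₘ * ⟪ T , n ⟫ₘ))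
  + κ * ∑ (splittings r) (λ (S , T) → ∑ (removals k n) (λ d → ⟪ S , m ⟫ₘ * ⟪ T , d ⟫ₘ))
    ≡⟨ cong₂ _+_ (sym (∑-*ˡ (splittings r) κ _)) (sym (∑-*ˡ (splittings r) κ _)) ⟩
  ∑ (splittings r) (λ (S , T) → κ * ∑ (removals k m) (λ d → ⟪ S , d ⟫ₘ * ⟪ T , n ⟫ₘ))
  + ∑ (splittings r) (λ (S , T) → κ * ∑ (removals k n) (λ d → ⟪ S , m ⟫ₘ * ⟪ T , d ⟫ₘ))
    ≡⟨ cong₂ _+_ (∑-cong (splittings r) λ (S , T) → trans (cong (κ *_) (∑-*ʳ (removals k m) ⟪ T , n ⟫ₘ ⟪ S ,_⟫ₘ))
                                                          (sym (ℚ.*-assoc κ _ ⟪ T , n ⟫ₘ)))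
                 (∑-cong (splittings r) λ (S , T) → trans (cong (κ *_) (∑-*ˡ (removals k n) ⟪ S , m ⟫ₘ ⟪ T ,_⟫ₘ))
                                                          (ℚ*-Properties.x∙yz≈y∙xz κ ⟪ S , m ⟫ₘ _)) ⟩
  ∑ (splittings r) (λ (S , T) → ⟪ k ∷ S , m ⟫ₘ * ⟪ T , n ⟫ₘ) + ∑ (splittings r) (λ (S , T) → ⟪ S , m ⟫ₘ * ⟪ k ∷ T , n ⟫ₘ)
    ≡⟨ ∑-splittings-∷ k r (λ (S , T) → ⟪ S , m ⟫ₘ * ⟪ T , n ⟫ₘ) ⟨
  ∑ (splittings (k ∷ r)) (λ (S , T) → ⟪ S , m ⟫ₘ * ⟪ T , n ⟫ₘ)
    ∎
  where
  κ : ℚ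
  κ = fromℕℚ k

⟪⟫ₘ-·ₘ : ∀ r m n → ⟪ r , m ·ₘ n ⟫ₘ ≡ ∑ (splittings r) (λ (S , T) → ⟪ S , m ⟫ₘ * ⟪ T , n ⟫ₘ)
⟪⟫ₘ-·ₘ r m n = trans (⟪⟫ₘ-↭ r (·ₘ-↭ m n)) (⟪⟫ₘ-++ r m n)

head-≥ : ∀ {x xs} → Decreasing (x ∷ xs) → All (_≤ x) xs
head-≥ x↘xs with Linked⇒AllPairs (λ x≥y y≥z → ℕ.≤-trans y≥z x≥y) x↘xs
... | x≥xs ∷ _ = x≥xs

mult-∷-≡ : ∀ k xs → mult k (k ∷ xs) ≡ suc (mult k xs)
mult-∷-≡ k xs = cong L.length (filter-accept (ℕ._≟ k) refl)

mult-∷-≢ : ∀ {i x} xs → x ≢ i → mult i (x ∷ xs) ≡ mult i xs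
mult-∷-≢ {i} xs x≢i = cong L.length (filter-reject (ℕ._≟ i) x≢i)

mult-< : ∀ {k n} → All (ℕ._< k) n → mult k n ≡ 0
mult-< [] = refl
mult-< {n = _ ∷ n} (x<k ∷ n<k) = trans (mult-∷-≢ n (ℕ.<⇒≢ x<k)) (mult-< n<k)

mult->sum : ∀ i m → sum m ℕ.< i → mult i m ≡ 0
mult->sum i m sum<i = mult-< (All.tabulate (λ {x} x∈m → ℕ.≤-<-trans (x≤sum m x∈m) sum<i))
  where
  x≤sum : ∀ m {x} → x ∈ m → x ≤ sum m
  x≤sum (y ∷ m) (here refl) = ℕ.m≤m+n y (sum m)
  x≤sum (y ∷ m) (there x∈m) = ℕ.≤-trans (x≤sum m x∈m) (ℕ.m≤n+m (sum m) y)

removals-< : ∀ {k n} → All (ℕ._< k) n → removals k n ≡ []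
removals-< [] = refl
removals-< {k} {x ∷ n} (x<k ∷ n<k) rewrite dec-false (x ℕ.≟ k) (ℕ.<⇒≢ x<k) | removals-< n<k = refl

∏₁ : ℕ → (ℕ → ℕ) → ℕ
∏₁ n g = product (map g (map suc (upTo n)))

∏₁-suc : ∀ n g → ∏₁ (suc n) g ≡ ∏₁ n g ℕ.* g (suc n)
∏₁-suc n g = begin
  product (map g (map suc (upTo (suc n))))              ≡⟨ cong (λ l → product (map g (map suc l))) (upTo-∷ʳ n) ⟨
  product (map g (map suc (upTo n L.∷ʳ n)))             ≡⟨ cong (λ l → product (map g l)) (map-++ suc (upTo n) (n ∷ [])) ⟩
  product (map g (map suc (upTo n) ++ suc n ∷ []))      ≡⟨ cong product (map-++ g (map suc (upTo n)) (suc n ∷ [])) ⟩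
  product (map g (map suc (upTo n)) ++ g (suc n) ∷ [])  ≡⟨ product-++ (map g (map suc (upTo n))) (g (suc n) ∷ []) ⟩
  ∏₁ n g ℕ.* (g (suc n) ℕ.* 1)                          ≡⟨ cong (∏₁ n g ℕ.*_) (ℕ.*-identityʳ (g (suc n))) ⟩
  ∏₁ n g ℕ.* g (suc n)                                  ∎

∏₁-cong : ∀ n {g g′} → (∀ i → i ≤ n → g i ≡ g′ i) → ∏₁ n g ≡ ∏₁ n g′
∏₁-cong zero g≡g′ = refl
∏₁-cong (suc n) {g} {g′} g≡g′ = begin
  ∏₁ (suc n) g           ≡⟨ ∏₁-suc n g ⟩
  ∏₁ n g ℕ.* g (suc n)   ≡⟨ cong₂ ℕ._*_ (∏₁-cong n (λ i i≤n → g≡g′ i (ℕ.m≤n⇒m≤1+n i≤n))) (g≡g′ (suc n) ℕ.≤-refl) ⟩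
  ∏₁ n g′ ℕ.* g′ (suc n) ≡⟨ ∏₁-suc n g′ ⟨
  ∏₁ (suc n) g′          ∎

∏₁-update : ∀ n {k} a {g g′} → 1 ≤ k → k ≤ n → (∀ i → i ≢ k → g′ i ≡ g i) → g′ k ≡ a ℕ.* g k →
            ∏₁ n g′ ≡ a ℕ.* ∏₁ n g
∏₁-update zero a 1≤k k≤0 _ _ = ⊥-elim (ℕ.<-irrefl refl (ℕ.≤-trans 1≤k k≤0))
∏₁-update (suc n) {k} a {g} {g′} 1≤k k≤n g′≡g g′k with k ℕ.≟ suc n
... | yes refl = begin
  ∏₁ (suc n) g′                ≡⟨ ∏₁-suc n g′ ⟩
  ∏₁ n g′ ℕ.* g′ (suc n)       ≡⟨ cong₂ ℕ._*_ (∏₁-cong n (λ i i≤n → g′≡g i (ℕ.<⇒≢ (s≤s i≤n)))) g′k ⟩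
  ∏₁ n g ℕ.* (a ℕ.* g (suc n)) ≡⟨ ℕ*-Properties.x∙yz≈y∙xz (∏₁ n g) a (g (suc n)) ⟩
  a ℕ.* (∏₁ n g ℕ.* g (suc n)) ≡⟨ cong (a ℕ.*_) (∏₁-suc n g) ⟨
  a ℕ.* ∏₁ (suc n) g           ∎
... | no k≢1+n = begin
  ∏₁ (suc n) g′                ≡⟨ ∏₁-suc n g′ ⟩
  ∏₁ n g′ ℕ.* g′ (suc n)       ≡⟨ cong₂ ℕ._*_ (∏₁-update n a 1≤k (ℕ.≤-pred (ℕ.≤∧≢⇒< k≤n k≢1+n)) g′≡g g′k)
                                                (g′≡g (suc n) (k≢1+n ∘ sym)) ⟩
  a ℕ.* ∏₁ n g ℕ.* g (suc n)   ≡⟨ ℕ.*-assoc a (∏₁ n g) (g (suc n)) ⟩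
  a ℕ.* (∏₁ n g ℕ.* g (suc n)) ≡⟨ cong (a ℕ.*_) (∏₁-suc n g) ⟨
  a ℕ.* ∏₁ (suc n) g           ∎

∏₁-+ : ∀ n {g} → (∀ i → n ℕ.< i → g i ≡ 1) → ∀ t → ∏₁ (n ℕ.+ t) g ≡ ∏₁ n g
∏₁-+ n g≡1 zero = cong (λ m → ∏₁ m _) (ℕ.+-identityʳ n)
∏₁-+ n {g} g≡1 (suc t) = begin
  ∏₁ (n ℕ.+ suc t) g                  ≡⟨ cong (λ m → ∏₁ m g) (ℕ.+-suc n t) ⟩
  ∏₁ (suc (n ℕ.+ t)) g                ≡⟨ ∏₁-suc (n ℕ.+ t) g ⟩
  ∏₁ (n ℕ.+ t) g ℕ.* g (suc (n ℕ.+ t)) ≡⟨ cong₂ ℕ._*_ (∏₁-+ n g≡1 t) (g≡1 (suc (n ℕ.+ t)) (s≤s (ℕ.m≤m+n n t))) ⟩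
  ∏₁ n g ℕ.* 1                        ≡⟨ ℕ.*-identityʳ (∏₁ n g) ⟩
  ∏₁ n g                              ∎

z-∷ : ∀ k m → 0 ℕ.< k → z (k ∷ m) ≡ k ℕ.* suc (mult k m) ℕ.* z m
z-∷ k m 0<k = begin
  ∏₁ (k ℕ.+ sum m) (factor (k ∷ m))            ≡⟨ ∏₁-update (k ℕ.+ sum m) (k ℕ.* suc c) 0<k (ℕ.m≤m+n k (sum m))
                                                     (λ i i≢k → cong (λ c → (i ^ c) ℕ.* c !) (mult-∷-≢ m (i≢k ∘ sym)))
                                                     (trans (cong (λ c → (k ^ c) ℕ.* c !) (mult-∷-≡ k m)) bump) ⟩
  k ℕ.* suc c ℕ.* ∏₁ (k ℕ.+ sum m) (factor m)  ≡⟨ cong (λ n → k ℕ.* suc c ℕ.* ∏₁ n (factor m)) (ℕ.+-comm k (sum m)) ⟩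
  k ℕ.* suc c ℕ.* ∏₁ (sum m ℕ.+ k) (factor m)  ≡⟨ cong (k ℕ.* suc c ℕ.*_)
                                                     (∏₁-+ (sum m) (λ i sum<i → cong (λ c → (i ^ c) ℕ.* c !) (mult->sum i m sum<i)) k) ⟩
  k ℕ.* suc c ℕ.* z m                          ∎
  where
  c : ℕ
  c = mult k m
  factor : List ℕ → ℕ → ℕ
  factor xs i = (i ^ mult i xs) ℕ.* mult i xs !
  bump : k ^ suc c ℕ.* suc c ! ≡ k ℕ.* suc c ℕ.* (k ^ c ℕ.* c !)
  bump = ℕ*-Properties.interchange k (k ^ c) (suc c) (c !)

∑-removals-head : ∀ k n (F : Mono → ℚ) → Decreasing (k ∷ n) →
                  ∑ (removals k n) (λ d → F (k ∷ d)) ≡ fromℕℚ (mult k n) * F n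
∑-removals-head k [] F _ = sym (ℚ.*-zeroˡ (F []))
∑-removals-head k (y ∷ n) F (k≥y ∷ k↘n) with ℕ.m≤n⇒m<n∨m≡n k≥y
... | inj₁ y<k rewrite removals-< (y<k ∷ All.map (λ w≤y → ℕ.≤-<-trans w≤y y<k) (head-≥ k↘n))
                     | mult-< (y<k ∷ All.map (λ w≤y → ℕ.≤-<-trans w≤y y<k) (head-≥ k↘n)) = sym (ℚ.*-zeroˡ (F (y ∷ n)))
... | inj₂ refl = begin
  ∑ (removals k (k ∷ n)) (λ d → F (k ∷ d))
    ≡⟨ ∑-removals-∷ k k n (λ d → F (k ∷ d)) ⟩
  𝟙 (k ℕ.≟ k) * F (k ∷ n) + ∑ (removals k n) (λ d → F (k ∷ k ∷ d))
    ≡⟨ cong₂ _+_ (trans (cong (_* F (k ∷ n)) (𝟙-yes (k ℕ.≟ k) refl)) (ℚ.*-identityˡ (F (k ∷ n))))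
                 (∑-removals-head k n (λ d → F (k ∷ d)) k↘n) ⟩
  F (k ∷ n) + fromℕℚ (mult k n) * F (k ∷ n)
    ≡⟨ cong (_+ fromℕℚ (mult k n) * F (k ∷ n)) (ℚ.*-identityˡ (F (k ∷ n))) ⟨
  1ℚ * F (k ∷ n) + fromℕℚ (mult k n) * F (k ∷ n)
    ≡⟨ ℚ.*-distribʳ-+ (F (k ∷ n)) 1ℚ (fromℕℚ (mult k n)) ⟨
  (1ℚ + fromℕℚ (mult k n)) * F (k ∷ n)
    ≡⟨ cong (_* F (k ∷ n)) (trans (sym (fromℕℚ-+ 1 (mult k n))) (cong fromℕℚ (sym (mult-∷-≡ k n)))) ⟩
  fromℕℚ (mult k (k ∷ n)) * F (k ∷ n)
    ∎

⟪⟫ₘ-∷-∷ : ∀ k μ n → Decreasing (k ∷ n) → ⟪ k ∷ μ , k ∷ n ⟫ₘ ≡ fromℕℚ k * (fromℕℚ (suc (mult k n)) * ⟪ μ , n ⟫ₘ)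
⟪⟫ₘ-∷-∷ k μ n k↘n = cong (fromℕℚ k *_) (begin
  ∑ (removals k (k ∷ n)) ⟪ μ ,_⟫ₘ
    ≡⟨ ∑-removals-∷ k k n ⟪ μ ,_⟫ₘ ⟩
  𝟙 (k ℕ.≟ k) * ⟪ μ , n ⟫ₘ + ∑ (removals k n) (λ d → ⟪ μ , k ∷ d ⟫ₘ)
    ≡⟨ cong₂ _+_ (cong (_* ⟪ μ , n ⟫ₘ) (𝟙-yes (k ℕ.≟ k) refl)) (∑-removals-head k n ⟪ μ ,_⟫ₘ k↘n) ⟩
  1ℚ * ⟪ μ , n ⟫ₘ + fromℕℚ (mult k n) * ⟪ μ , n ⟫ₘ
    ≡⟨ ℚ.*-distribʳ-+ ⟪ μ , n ⟫ₘ 1ℚ (fromℕℚ (mult k n)) ⟨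
  (1ℚ + fromℕℚ (mult k n)) * ⟪ μ , n ⟫ₘ
    ≡⟨ cong (_* ⟪ μ , n ⟫ₘ) (fromℕℚ-+ 1 (mult k n)) ⟨
  fromℕℚ (suc (mult k n)) * ⟪ μ , n ⟫ₘ
    ∎)

⟪⟫ₘ-∉ : ∀ {x} r → All (x ≢_) r → ∀ d → ⟪ r , x ∷ d ⟫ₘ ≡ 0ℚ
⟪⟫ₘ-∉ [] _ d = refl
⟪⟫ₘ-∉ {x} (k ∷ r) (x≢k ∷ x∉r) d = begin
  fromℕℚ k * ∑ (removals k (x ∷ d)) ⟪ r ,_⟫ₘ
    ≡⟨ cong (fromℕℚ k *_) (∑-removals-∷ k x d ⟪ r ,_⟫ₘ) ⟩
  fromℕℚ k * (𝟙 (x ℕ.≟ k) * ⟪ r , d ⟫ₘ + ∑ (removals k d) (λ d′ → ⟪ r , x ∷ d′ ⟫ₘ))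
    ≡⟨ cong₂ (λ a b → fromℕℚ k * (a * ⟪ r , d ⟫ₘ + b)) (𝟙-no (x ℕ.≟ k) x≢k)
             (trans (∑-cong (removals k d) (⟪⟫ₘ-∉ r x∉r)) (∑-zero (removals k d))) ⟩
  fromℕℚ k * (0ℚ * ⟪ r , d ⟫ₘ + 0ℚ)
    ≡⟨ cong (fromℕℚ k *_) (trans (ℚ.+-identityʳ _) (ℚ.*-zeroˡ ⟪ r , d ⟫ₘ)) ⟩
  fromℕℚ k * 0ℚ
    ≡⟨ ℚ.*-zeroʳ (fromℕℚ k) ⟩
  0ℚ
    ∎

⟪⟫ₘ-diagonal : ∀ μ → Positive μ → Decreasing μ → ⟪ μ , μ ⟫ₘ ≡ fromℕℚ (z μ)
⟪⟫ₘ-diagonal [] _ _ = refl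
⟪⟫ₘ-diagonal (k ∷ μ) (0<k ∷ μ>0) k↘μ = begin
  ⟪ k ∷ μ , k ∷ μ ⟫ₘ
    ≡⟨ ⟪⟫ₘ-∷-∷ k μ μ k↘μ ⟩
  fromℕℚ k * (fromℕℚ (suc (mult k μ)) * ⟪ μ , μ ⟫ₘ)
    ≡⟨ cong (λ v → fromℕℚ k * (fromℕℚ (suc (mult k μ)) * v)) (⟪⟫ₘ-diagonal μ μ>0 (Linked.tail k↘μ)) ⟩
  fromℕℚ k * (fromℕℚ (suc (mult k μ)) * fromℕℚ (z μ))
    ≡⟨ trans (sym (ℚ.*-assoc (fromℕℚ k) _ _)) (sym (trans (fromℕℚ-* (k ℕ.* suc (mult k μ)) (z μ))
                                                          (cong (_* fromℕℚ (z μ)) (fromℕℚ-* k (suc (mult k μ)))))) ⟩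
  fromℕℚ (k ℕ.* suc (mult k μ) ℕ.* z μ)
    ≡⟨ cong fromℕℚ (z-∷ k μ 0<k) ⟨
  fromℕℚ (z (k ∷ μ))
    ∎

⟪⟫ₘ-off-diagonal : ∀ μ n → Decreasing μ → Decreasing n → μ ≢ n → ⟪ μ , n ⟫ₘ ≡ 0ℚ
⟪⟫ₘ-off-diagonal [] [] _ _ μ≢n = ⊥-elim (μ≢n refl)
⟪⟫ₘ-off-diagonal [] (_ ∷ _) _ _ _ = refl
⟪⟫ₘ-off-diagonal (k ∷ μ) [] _ _ _ = ℚ.*-zeroʳ (fromℕℚ k)
⟪⟫ₘ-off-diagonal (k ∷ μ) (x ∷ n) k↘μ x↘n μ≢n with ℕ.<-cmp x k
... | tri≈ _ refl _ = begin
  ⟪ k ∷ μ , k ∷ n ⟫ₘ                                 ≡⟨ ⟪⟫ₘ-∷-∷ k μ n x↘n ⟩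
  fromℕℚ k * (fromℕℚ (suc (mult k n)) * ⟪ μ , n ⟫ₘ)  ≡⟨ cong (λ v → fromℕℚ k * (fromℕℚ (suc (mult k n)) * v))
                                                          (⟪⟫ₘ-off-diagonal μ n (Linked.tail k↘μ) (Linked.tail x↘n) (μ≢n ∘ cong (k ∷_))) ⟩
  fromℕℚ k * (fromℕℚ (suc (mult k n)) * 0ℚ)          ≡⟨ cong (fromℕℚ k *_) (ℚ.*-zeroʳ (fromℕℚ (suc (mult k n)))) ⟩
  fromℕℚ k * 0ℚ                                      ≡⟨ ℚ.*-zeroʳ (fromℕℚ k) ⟩
  0ℚ                                                 ∎
... | tri< x<k _ _ rewrite removals-< (x<k ∷ All.map (λ w≤x → ℕ.≤-<-trans w≤x x<k) (head-≥ x↘n)) = ℚ.*-zeroʳ (fromℕℚ k)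
... | tri> _ _ k<x = ⟪⟫ₘ-∉ (k ∷ μ) (ℕ.>⇒≢ k<x ∷ All.map (λ w≤k → ℕ.>⇒≢ (ℕ.≤-<-trans w≤k k<x)) (head-≥ k↘μ)) n

⟪_,_⟫ : List ℕ → Sym → ℚ
⟪ r , f ⟫ = ∑ f (λ (a , m) → a * ⟪ r , m ⟫ₘ)

-- ⟨_,_⟩ compares monomials as lists, so it agrees with ⟪_,_⟫ only on sorted monomials.
DecreasingTerms : Sym → Set
DecreasingTerms = All (Decreasing ∘ proj₂)

insertD-head : ∀ {k μ} → Decreasing (k ∷ μ) → insertD k μ ≡ k ∷ μ
insertD-head {μ = []} _ = refl
insertD-head {k} {x ∷ μ} (k≥x ∷ _) with x ℕ.≤ᵇ k | ℕ.≤⇒≤ᵇ k≥x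
... | true | _ = refl

insertD-decreasing : ∀ k {xs} → Decreasing xs → Decreasing (insertD k xs)
insertD-decreasing k {[]} _ = [-]
insertD-decreasing k {x ∷ xs} x↘xs with x ℕ.≤ᵇ k | ℕ.≤ᵇ⇒≤ x k | ℕ.≤⇒≤ᵇ {x} {k}
... | true | x≤k | _ = x≤k tt ∷ x↘xs
... | false | _ | x≰k = below x (ℕ.≰⇒≥ x≰k) x↘xs
  where
  below : ∀ y {ys} → k ≤ y → Decreasing (y ∷ ys) → Decreasing (y ∷ insertD k ys)
  below y {[]} k≤y _ = k≤y ∷ [-]
  below y {x ∷ ys} k≤y (y≥x ∷ x↘ys) with x ℕ.≤ᵇ k | ℕ.≤ᵇ⇒≤ x k | ℕ.≤⇒≤ᵇ {x} {k}
  ... | true | x≤k | _ = k≤y ∷ x≤k tt ∷ x↘ys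
  ... | false | _ | x≰k = y≥x ∷ below x (ℕ.≰⇒≥ x≰k) x↘ys

⊗-decreasing : ∀ f {g} → DecreasingTerms g → DecreasingTerms (f ⊗ g)
⊗-decreasing [] g↘ = []
⊗-decreasing ((a , m) ∷ f) g↘ = ++⁺ (map⁺ (All.map (·ₘ-decreasing m) g↘)) (⊗-decreasing f g↘)
  where
  ·ₘ-decreasing : ∀ m {n} → Decreasing n → Decreasing (m ·ₘ n)
  ·ₘ-decreasing [] n↘ = n↘
  ·ₘ-decreasing (x ∷ m) n↘ = insertD-decreasing x (·ₘ-decreasing m n↘)

ePart-decreasing : ∀ τ → DecreasingTerms (ePart τ)
ePart-decreasing [] = [] ∷ []
ePart-decreasing (k ∷ τ) = ⊗-decreasing (e k) (ePart-decreasing τ)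

pPart-decreasing : ∀ {μ} → Decreasing μ → pPart μ ≡ (1ℚ , μ) ∷ []
pPart-decreasing {[]} _ = refl
pPart-decreasing {k ∷ μ} k↘μ = begin
  p k ⊗ pPart μ            ≡⟨ cong (p k ⊗_) (pPart-decreasing (Linked.tail k↘μ)) ⟩
  p k ⊗ ((1ℚ , μ) ∷ [])    ≡⟨ cong₂ (λ a m → (a , m) ∷ []) (ℚ.*-identityˡ 1ℚ) (insertD-head k↘μ) ⟩
  (1ℚ , k ∷ μ) ∷ []        ∎

⟨pPart,⟩≡⟪,⟫ : ∀ {μ g} → Positive μ → Decreasing μ → DecreasingTerms g → ⟨ pPart μ , g ⟩ ≡ ⟪ μ , g ⟫
⟨pPart,⟩≡⟪,⟫ {μ} {g} μ>0 μ↘ g↘ rewrite pPart-decreasing μ↘ =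
  trans (cong sumℚ (++-identityʳ (map term g))) (∑-cong-All g↘ λ (b , n) n↘ → term≡ b n n↘ (≡-dec ℕ._≟_ μ n))
  where
  term : ℚ × Mono → ℚ
  term (b , n) = if ⌊ ≡-dec ℕ._≟_ μ n ⌋ then 1ℚ * b * fromℕℚ (z μ) else 0ℚ
  term≡ : ∀ b n → Decreasing n → (μ≟n : Dec (μ ≡ n)) →
          (if ⌊ μ≟n ⌋ then 1ℚ * b * fromℕℚ (z μ) else 0ℚ) ≡ b * ⟪ μ , n ⟫ₘ
  term≡ b n n↘ (yes refl) = trans (cong (_* fromℕℚ (z μ)) (ℚ.*-identityˡ b)) (cong (b *_) (sym (⟪⟫ₘ-diagonal μ μ>0 μ↘)))
  term≡ b n n↘ (no μ≢n) = sym (trans (cong (b *_) (⟪⟫ₘ-off-diagonal μ n μ↘ n↘ μ≢n)) (ℚ.*-zeroʳ b))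

record Linear (L : Sym → ℚ) : Set where
  field
    ++-hom : ∀ f g → L (f ++ g) ≡ L f + L g
    scale-hom : ∀ c f → L (scale c f) ≡ c * L f

  []-hom : L [] ≡ 0ℚ
  []-hom = trans (scale-hom 0ℚ []) (ℚ.*-zeroˡ (L []))

  concatMap-hom : ∀ (F : A → Sym) xs → L (concatMap F xs) ≡ ∑ xs (L ∘ F)
  concatMap-hom F [] = []-hom
  concatMap-hom F (x ∷ xs) = trans (++-hom (F x) (concatMap F xs)) (cong (_+_ (L (F x))) (concatMap-hom F xs))

  concatMap-scale-hom : ∀ c (F : A → Sym) xs → L (concatMap (λ x → scale c (F x)) xs) ≡ ∑ xs (λ x → c * L (F x))
  concatMap-scale-hom c F xs = trans (concatMap-hom (λ x → scale c (F x)) xs) (∑-cong xs (λ x → scale-hom c (F x)))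

open Linear

⟪⟫-linear : ∀ r → Linear ⟪ r ,_⟫
⟪⟫-linear r .++-hom f g = ∑-++ f g _
⟪⟫-linear r .scale-hom c f =
  trans (∑-map _ f _) (trans (∑-cong f (λ (a , m) → ℚ.*-assoc c a ⟪ r , m ⟫ₘ)) (∑-*ˡ f c _))

⟪⟫-⊗ : ∀ r f g → ⟪ r , f ⊗ g ⟫ ≡ ∑ (splittings r) (λ (S , T) → ⟪ S , f ⟫ * ⟪ T , g ⟫)
⟪⟫-⊗ r f g = begin
  ⟪ r , f ⊗ g ⟫
    ≡⟨ ∑-concatMap _ f _ ⟩
  ∑ f (λ (a , m) → ∑ (map (λ (b , n) → (a * b , m ·ₘ n)) g) (λ (c , o) → c * ⟪ r , o ⟫ₘ))
    ≡⟨ ∑-cong f (λ _ → ∑-map _ g _) ⟩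
  ∑ f (λ (a , m) → ∑ g (λ (b , n) → (a * b) * ⟪ r , m ·ₘ n ⟫ₘ))
    ≡⟨ ∑-cong f (λ (a , m) → ∑-cong g λ (b , n) → cong ((a * b) *_) (⟪⟫ₘ-·ₘ r m n)) ⟩
  ∑ f (λ (a , m) → ∑ g (λ (b , n) → (a * b) * ∑ (splittings r) (λ (S , T) → ⟪ S , m ⟫ₘ * ⟪ T , n ⟫ₘ)))
    ≡⟨ ∑-cong f (λ (a , m) → ∑-cong g λ (b , n) → trans (sym (∑-*ˡ (splittings r) (a * b) _))
         (∑-cong (splittings r) λ (S , T) → ℚ*-Properties.interchange a b ⟪ S , m ⟫ₘ ⟪ T , n ⟫ₘ)) ⟩
  ∑ f (λ (a , m) → ∑ g (λ (b , n) → ∑ (splittings r) (λ (S , T) → (a * ⟪ S , m ⟫ₘ) * (b * ⟪ T , n ⟫ₘ))))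
    ≡⟨ ∑-cong f (λ _ → ∑-swap g (splittings r) _) ⟩
  ∑ f (λ (a , m) → ∑ (splittings r) (λ (S , T) → ∑ g (λ (b , n) → (a * ⟪ S , m ⟫ₘ) * (b * ⟪ T , n ⟫ₘ))))
    ≡⟨ ∑-swap f (splittings r) _ ⟩
  ∑ (splittings r) (λ (S , T) → ∑ f (λ (a , m) → ∑ g (λ (b , n) → (a * ⟪ S , m ⟫ₘ) * (b * ⟪ T , n ⟫ₘ))))
    ≡⟨ ∑-cong (splittings r) (λ (S , T) → sym (∑*∑ f g _ _)) ⟩
  ∑ (splittings r) (λ (S , T) → ⟪ S , f ⟫ * ⟪ T , g ⟫)
    ∎

⟪[]⟫-⊗ : ∀ f g → ⟪ [] , f ⊗ g ⟫ ≡ ⟪ [] , f ⟫ * ⟪ [] , g ⟫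
⟪[]⟫-⊗ f g = trans (⟪⟫-⊗ [] f g) (ℚ.+-identityʳ _)

⊗-linearˡ : ∀ r g → Linear (λ f → ⟪ r , f ⊗ g ⟫)
⊗-linearˡ r g .++-hom f f′ = begin
  ⟪ r , (f ++ f′) ⊗ g ⟫
    ≡⟨ ⟪⟫-⊗ r (f ++ f′) g ⟩
  ∑ (splittings r) (λ (S , T) → ⟪ S , f ++ f′ ⟫ * ⟪ T , g ⟫)
    ≡⟨ ∑-cong (splittings r) (λ (S , T) → trans (cong (_* ⟪ T , g ⟫) (∑-++ f f′ _)) (ℚ.*-distribʳ-+ ⟪ T , g ⟫ ⟪ S , f ⟫ ⟪ S , f′ ⟫)) ⟩
  ∑ (splittings r) (λ (S , T) → ⟪ S , f ⟫ * ⟪ T , g ⟫ + ⟪ S , f′ ⟫ * ⟪ T , g ⟫)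
    ≡⟨ ∑-+ (splittings r) _ _ ⟩
  ∑ (splittings r) (λ (S , T) → ⟪ S , f ⟫ * ⟪ T , g ⟫) + ∑ (splittings r) (λ (S , T) → ⟪ S , f′ ⟫ * ⟪ T , g ⟫)
    ≡⟨ cong₂ _+_ (⟪⟫-⊗ r f g) (⟪⟫-⊗ r f′ g) ⟨
  ⟪ r , f ⊗ g ⟫ + ⟪ r , f′ ⊗ g ⟫
    ∎
⊗-linearˡ r g .scale-hom c f = begin
  ⟪ r , scale c f ⊗ g ⟫
    ≡⟨ ⟪⟫-⊗ r (scale c f) g ⟩
  ∑ (splittings r) (λ (S , T) → ⟪ S , scale c f ⟫ * ⟪ T , g ⟫)
    ≡⟨ ∑-cong (splittings r) (λ (S , T) → trans (cong (_* ⟪ T , g ⟫) (scale-hom (⟪⟫-linear S) c f)) (ℚ.*-assoc c ⟪ S , f ⟫ ⟪ T , g ⟫)) ⟩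
  ∑ (splittings r) (λ (S , T) → c * (⟪ S , f ⟫ * ⟪ T , g ⟫))
    ≡⟨ ∑-*ˡ (splittings r) c _ ⟩
  c * ∑ (splittings r) (λ (S , T) → ⟪ S , f ⟫ * ⟪ T , g ⟫)
    ≡⟨ cong (c *_) (⟪⟫-⊗ r f g) ⟨
  c * ⟪ r , f ⊗ g ⟫
    ∎

⊗-linearʳ : ∀ r f (M : Sym → Sym) → (∀ T → Linear (λ g → ⟪ T , M g ⟫)) → Linear (λ g → ⟪ r , f ⊗ M g ⟫)
⊗-linearʳ r f M M-linear .++-hom g g′ = begin
  ⟪ r , f ⊗ M (g ++ g′) ⟫
    ≡⟨ ⟪⟫-⊗ r f (M (g ++ g′)) ⟩
  ∑ (splittings r) (λ (S , T) → ⟪ S , f ⟫ * ⟪ T , M (g ++ g′) ⟫)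
    ≡⟨ ∑-cong (splittings r) (λ (S , T) → trans (cong (⟪ S , f ⟫ *_) (++-hom (M-linear T) g g′))
                                                (ℚ.*-distribˡ-+ ⟪ S , f ⟫ ⟪ T , M g ⟫ ⟪ T , M g′ ⟫)) ⟩
  ∑ (splittings r) (λ (S , T) → ⟪ S , f ⟫ * ⟪ T , M g ⟫ + ⟪ S , f ⟫ * ⟪ T , M g′ ⟫)
    ≡⟨ ∑-+ (splittings r) _ _ ⟩
  ∑ (splittings r) (λ (S , T) → ⟪ S , f ⟫ * ⟪ T , M g ⟫) + ∑ (splittings r) (λ (S , T) → ⟪ S , f ⟫ * ⟪ T , M g′ ⟫)
    ≡⟨ cong₂ _+_ (⟪⟫-⊗ r f (M g)) (⟪⟫-⊗ r f (M g′)) ⟨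
  ⟪ r , f ⊗ M g ⟫ + ⟪ r , f ⊗ M g′ ⟫
    ∎
⊗-linearʳ r f M M-linear .scale-hom c g = begin
  ⟪ r , f ⊗ M (scale c g) ⟫
    ≡⟨ ⟪⟫-⊗ r f (M (scale c g)) ⟩
  ∑ (splittings r) (λ (S , T) → ⟪ S , f ⟫ * ⟪ T , M (scale c g) ⟫)
    ≡⟨ ∑-cong (splittings r) (λ (S , T) → trans (cong (⟪ S , f ⟫ *_) (scale-hom (M-linear T) c g))
                                                (ℚ*-Properties.x∙yz≈y∙xz ⟪ S , f ⟫ c ⟪ T , M g ⟫)) ⟩
  ∑ (splittings r) (λ (S , T) → c * (⟪ S , f ⟫ * ⟪ T , M g ⟫))
    ≡⟨ ∑-*ˡ (splittings r) c _ ⟩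
  c * ∑ (splittings r) (λ (S , T) → ⟪ S , f ⟫ * ⟪ T , M g ⟫)
    ≡⟨ cong (c *_) (⟪⟫-⊗ r f (M g)) ⟨
  c * ⟪ r , f ⊗ M g ⟫
    ∎

-- The derivation k ∂/∂p_k

∂ : ℕ → Sym → Sym
∂ k f = concatMap (λ (a , m) → map (λ d → (a * fromℕℚ k , d)) (removals k m)) f

⟪⟫-∂ : ∀ k r f → ⟪ r , ∂ k f ⟫ ≡ ⟪ k ∷ r , f ⟫
⟪⟫-∂ k r f = trans (∑-concatMap _ f _) (∑-cong f λ (a , m) → begin
  ∑ (map (λ d → (a * fromℕℚ k , d)) (removals k m)) (λ (b , n) → b * ⟪ r , n ⟫ₘ) ≡⟨ ∑-map _ (removals k m) _ ⟩
  ∑ (removals k m) (λ d → a * fromℕℚ k * ⟪ r , d ⟫ₘ)                           ≡⟨ ∑-*ˡ (removals k m) (a * fromℕℚ k) _ ⟩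
  a * fromℕℚ k * ∑ (removals k m) ⟪ r ,_⟫ₘ                                     ≡⟨ ℚ.*-assoc a (fromℕℚ k) _ ⟩
  a * ⟪ k ∷ r , m ⟫ₘ                                                           ∎)

⟪∷⟫-⊗ : ∀ k r f g → ⟪ k ∷ r , f ⊗ g ⟫ ≡ ⟪ r , ∂ k f ⊗ g ⟫ + ⟪ r , f ⊗ ∂ k g ⟫
⟪∷⟫-⊗ k r f g = begin
  ⟪ k ∷ r , f ⊗ g ⟫
    ≡⟨ ⟪⟫-⊗ (k ∷ r) f g ⟩
  ∑ (splittings (k ∷ r)) (λ (S , T) → ⟪ S , f ⟫ * ⟪ T , g ⟫)
    ≡⟨ ∑-splittings-∷ k r _ ⟩
  ∑ (splittings r) (λ (S , T) → ⟪ k ∷ S , f ⟫ * ⟪ T , g ⟫) + ∑ (splittings r) (λ (S , T) → ⟪ S , f ⟫ * ⟪ k ∷ T , g ⟫)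
    ≡⟨ cong₂ _+_ (∑-cong (splittings r) λ (S , T) → cong (_* ⟪ T , g ⟫) (⟪⟫-∂ k S f))
                 (∑-cong (splittings r) λ (S , T) → cong (⟪ S , f ⟫ *_) (⟪⟫-∂ k T g)) ⟨
  ∑ (splittings r) (λ (S , T) → ⟪ S , ∂ k f ⟫ * ⟪ T , g ⟫) + ∑ (splittings r) (λ (S , T) → ⟪ S , f ⟫ * ⟪ T , ∂ k g ⟫)
    ≡⟨ cong₂ _+_ (⟪⟫-⊗ r (∂ k f) g) (⟪⟫-⊗ r f (∂ k g)) ⟨
  ⟪ r , ∂ k f ⊗ g ⟫ + ⟪ r , f ⊗ ∂ k g ⟫
    ∎

infix 4 _≋_
record _≋_ (f g : Sym) : Set where
  field ⟪⟫-≡ : ∀ r → Positive r → ⟪ r , f ⟫ ≡ ⟪ r , g ⟫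

open _≋_

⊗-congˡ : ∀ {f f′} → f ≋ f′ → ∀ g → f ⊗ g ≋ f′ ⊗ g
⊗-congˡ {f} {f′} f≋f′ g .⟪⟫-≡ r r>0 = begin
  ⟪ r , f ⊗ g ⟫                                              ≡⟨ ⟪⟫-⊗ r f g ⟩
  ∑ (splittings r) (λ (S , T) → ⟪ S , f ⟫ * ⟪ T , g ⟫)       ≡⟨ ∑-cong-All (splittings-positive r>0) (λ (S , T) (S>0 , _) → cong (_* ⟪ T , g ⟫) (f≋f′ .⟪⟫-≡ S S>0)) ⟩
  ∑ (splittings r) (λ (S , T) → ⟪ S , f′ ⟫ * ⟪ T , g ⟫)      ≡⟨ ⟪⟫-⊗ r f′ g ⟨
  ⟪ r , f′ ⊗ g ⟫                                             ∎

⊗-congʳ : ∀ f {g g′} → g ≋ g′ → f ⊗ g ≋ f ⊗ g′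
⊗-congʳ f {g} {g′} g≋g′ .⟪⟫-≡ r r>0 = begin
  ⟪ r , f ⊗ g ⟫                                              ≡⟨ ⟪⟫-⊗ r f g ⟩
  ∑ (splittings r) (λ (S , T) → ⟪ S , f ⟫ * ⟪ T , g ⟫)       ≡⟨ ∑-cong-All (splittings-positive r>0) (λ (S , T) (_ , T>0) → cong (⟪ S , f ⟫ *_) (g≋g′ .⟪⟫-≡ T T>0)) ⟩
  ∑ (splittings r) (λ (S , T) → ⟪ S , f ⟫ * ⟪ T , g′ ⟫)      ≡⟨ ⟪⟫-⊗ r f g′ ⟨
  ⟪ r , f ⊗ g′ ⟫                                             ∎

∂-⊗ : ∀ k {f f′ g g′} → ∂ k f ≋ f′ → ∂ k g ≋ g′ → ∂ k (f ⊗ g) ≋ (f′ ⊗ g) ++ (f ⊗ g′)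
∂-⊗ k {f} {f′} {g} {g′} ∂f ∂g .⟪⟫-≡ r r>0 = begin
  ⟪ r , ∂ k (f ⊗ g) ⟫                       ≡⟨ ⟪⟫-∂ k r (f ⊗ g) ⟩
  ⟪ k ∷ r , f ⊗ g ⟫                         ≡⟨ ⟪∷⟫-⊗ k r f g ⟩
  ⟪ r , ∂ k f ⊗ g ⟫ + ⟪ r , f ⊗ ∂ k g ⟫     ≡⟨ cong₂ _+_ (⊗-congˡ ∂f g .⟪⟫-≡ r r>0) (⊗-congʳ f ∂g .⟪⟫-≡ r r>0) ⟩
  ⟪ r , f′ ⊗ g ⟫ + ⟪ r , f ⊗ g′ ⟫           ≡⟨ ++-hom (⟪⟫-linear r) (f′ ⊗ g) (f ⊗ g′) ⟨
  ⟪ r , (f′ ⊗ g) ++ (f ⊗ g′) ⟫              ∎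

-- Pairing with h_n and e_n

singletonValue : List ℕ → ℕ
singletonValue (s ∷ []) = s
singletonValue _ = 0

∑-splittings-singletonValue : ∀ r → ∑ (splittings r) (λ (S , _) → fromℕℚ (singletonValue S)) ≡ fromℕℚ (sum r)
∑-splittings-singletonValue [] = refl
∑-splittings-singletonValue (k ∷ r) = begin
  ∑ (splittings (k ∷ r)) (λ (S , _) → fromℕℚ (singletonValue S))
    ≡⟨ ∑-splittings-∷ k r _ ⟩
  ∑ (splittings r) (λ (S , _) → fromℕℚ (singletonValue (k ∷ S))) + ∑ (splittings r) (λ (S , _) → fromℕℚ (singletonValue S))
    ≡⟨ cong₂ _+_ (trans (∑-cong (splittings r) (λ (S , _) → singletonValue-∷ S)) (∑-*ˡ (splittings r) (fromℕℚ k) _))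
                 (∑-splittings-singletonValue r) ⟩
  fromℕℚ k * ∑ (splittings r) (λ (S , _) → 𝟙 (≡-dec ℕ._≟_ S [])) + fromℕℚ (sum r)
    ≡⟨ cong (λ x → fromℕℚ k * x + fromℕℚ (sum r)) (∑-splittings-[] r) ⟩
  fromℕℚ k * 1ℚ + fromℕℚ (sum r)
    ≡⟨ cong (_+ fromℕℚ (sum r)) (ℚ.*-identityʳ (fromℕℚ k)) ⟩
  fromℕℚ k + fromℕℚ (sum r)
    ≡⟨ fromℕℚ-+ k (sum r) ⟨
  fromℕℚ (k ℕ.+ sum r)
    ∎
  where
  singletonValue-∷ : ∀ S → fromℕℚ (singletonValue (k ∷ S)) ≡ fromℕℚ k * 𝟙 (≡-dec ℕ._≟_ S [])
  singletonValue-∷ [] = sym (ℚ.*-identityʳ (fromℕℚ k))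
  singletonValue-∷ (_ ∷ _) = sym (ℚ.*-zeroʳ (fromℕℚ k))
  ∑-splittings-[] : ∀ r → ∑ (splittings r) (λ (S , _) → 𝟙 (≡-dec ℕ._≟_ S [])) ≡ 1ℚ
  ∑-splittings-[] [] = refl
  ∑-splittings-[] (k ∷ r) = begin
    ∑ (splittings (k ∷ r)) (λ (S , _) → 𝟙 (≡-dec ℕ._≟_ S []))
      ≡⟨ ∑-splittings-∷ k r _ ⟩
    ∑ (splittings r) (λ _ → 0ℚ) + ∑ (splittings r) (λ (S , _) → 𝟙 (≡-dec ℕ._≟_ S []))
      ≡⟨ cong₂ _+_ (∑-zero (splittings r)) (∑-splittings-[] r) ⟩
    0ℚ + 1ℚ
      ≡⟨ ℚ.+-identityˡ 1ℚ ⟩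
    1ℚ
      ∎

⟪⟫-1S : ∀ r → Positive r → ⟪ r , 1S ⟫ ≡ 𝟙 (sum r ℕ.≟ 0)
⟪⟫-1S [] _ = refl
⟪⟫-1S (k ∷ r) (0<k ∷ _) = begin
  1ℚ * (fromℕℚ k * 0ℚ) + 0ℚ   ≡⟨ ℚ.+-identityʳ _ ⟩
  1ℚ * (fromℕℚ k * 0ℚ)        ≡⟨ ℚ.*-identityˡ _ ⟩
  fromℕℚ k * 0ℚ               ≡⟨ ℚ.*-zeroʳ (fromℕℚ k) ⟩
  0ℚ                          ≡⟨ 𝟙-no (k ℕ.+ sum r ℕ.≟ 0) (ℕ.>⇒≢ (ℕ.<-≤-trans 0<k (ℕ.m≤m+n k (sum r)))) ⟨
  𝟙 (k ℕ.+ sum r ℕ.≟ 0)       ∎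

⟪[]⟫-p : ∀ j → ⟪ [] , p j ⟫ ≡ 0ℚ
⟪[]⟫-p j = trans (ℚ.+-identityʳ _) (ℚ.*-zeroʳ 1ℚ)

⟪[-]⟫-p : ∀ s j → ⟪ s ∷ [] , p j ⟫ ≡ 𝟙 (j ℕ.≟ s) * fromℕℚ s
⟪[-]⟫-p s j = begin
  1ℚ * (fromℕℚ s * ∑ (removals s (j ∷ [])) ⟪ [] ,_⟫ₘ) + 0ℚ  ≡⟨ trans (ℚ.+-identityʳ _) (ℚ.*-identityˡ _) ⟩
  fromℕℚ s * ∑ (removals s (j ∷ [])) ⟪ [] ,_⟫ₘ              ≡⟨ cong (fromℕℚ s *_) (∑-removals-∷ s j [] ⟪ [] ,_⟫ₘ) ⟩
  fromℕℚ s * (𝟙 (j ℕ.≟ s) * 1ℚ + 0ℚ)                        ≡⟨ cong (fromℕℚ s *_) (trans (ℚ.+-identityʳ _) (ℚ.*-identityʳ _)) ⟩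
  fromℕℚ s * 𝟙 (j ℕ.≟ s)                                    ≡⟨ ℚ.*-comm (fromℕℚ s) _ ⟩
  𝟙 (j ℕ.≟ s) * fromℕℚ s                                    ∎

⟪∷∷⟫-p : ∀ s s′ S j → ⟪ s ∷ s′ ∷ S , p j ⟫ ≡ 0ℚ
⟪∷∷⟫-p s s′ S j = begin
  1ℚ * (fromℕℚ s * ∑ (removals s (j ∷ [])) ⟪ s′ ∷ S ,_⟫ₘ) + 0ℚ
    ≡⟨ trans (ℚ.+-identityʳ _) (ℚ.*-identityˡ _) ⟩
  fromℕℚ s * ∑ (removals s (j ∷ [])) ⟪ s′ ∷ S ,_⟫ₘ
    ≡⟨ cong (fromℕℚ s *_) (trans (∑-removals-∷ s j [] ⟪ s′ ∷ S ,_⟫ₘ) (trans (ℚ.+-identityʳ _) (cong (𝟙 (j ℕ.≟ s) *_) (ℚ.*-zeroʳ (fromℕℚ s′))))) ⟩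
  fromℕℚ s * (𝟙 (j ℕ.≟ s) * 0ℚ)
    ≡⟨ trans (cong (fromℕℚ s *_) (ℚ.*-zeroʳ (𝟙 (j ℕ.≟ s)))) (ℚ.*-zeroʳ (fromℕℚ s)) ⟩
  0ℚ
    ∎

1/suc-cancel : ∀ k n x → ((+ 1) ℚ./ suc k) * (fromℕℚ n * (𝟙 (n ℕ.≟ suc k) * x)) ≡ 𝟙 (n ℕ.≟ suc k) * x
1/suc-cancel k n x = cancel (n ℕ.≟ suc k)
  where
  c : ℚ
  c = (+ 1) ℚ./ suc k
  cancel : (n≟1+k : Dec (n ≡ suc k)) → c * (fromℕℚ n * (𝟙 n≟1+k * x)) ≡ 𝟙 n≟1+k * x
  cancel (yes refl) = begin
    c * (fromℕℚ (suc k) * (1ℚ * x)) ≡⟨ ℚ.*-assoc c (fromℕℚ (suc k)) (1ℚ * x) ⟨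
    c * fromℕℚ (suc k) * (1ℚ * x)   ≡⟨ cong (_* (1ℚ * x)) (1/suc*suc≡1 k) ⟩
    1ℚ * (1ℚ * x)                   ≡⟨ ℚ.*-identityˡ (1ℚ * x) ⟩
    1ℚ * x                          ∎
  cancel (no _) = begin
    c * (fromℕℚ n * (0ℚ * x)) ≡⟨ cong (λ y → c * (fromℕℚ n * y)) (ℚ.*-zeroˡ x) ⟩
    c * (fromℕℚ n * 0ℚ)       ≡⟨ trans (cong (c *_) (ℚ.*-zeroʳ (fromℕℚ n))) (ℚ.*-zeroʳ c) ⟩
    0ℚ                        ≡⟨ ℚ.*-zeroˡ x ⟨
    0ℚ * x                    ∎

-- The inductive step of Newton's identity (k+1) X_{k+1} = Σ_{i ≤ k} w_i p_{i+1} X_{k-i}, for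
-- h (w = 1, χ = 1) and e (w_i = (-1)^i, χ = sign).
module _ (w : ℕ → ℚ) (χ : List ℕ → ℚ) (χ-↭ : χ Preserves _↭_ ⟶ _≡_) (χ-∷ : ∀ s T → w s * χ T ≡ χ (suc s ∷ T))
         (E : ℕ → Sym) (k : ℕ) (E-pairing : ∀ s T → Positive T → ⟪ T , E s ⟫ ≡ 𝟙 (s ℕ.+ sum T ℕ.≟ k) * χ T) where

  private
    vanishing : ∀ S T → (∀ j → ⟪ S , p j ⟫ ≡ 0ℚ) → ∀ y →
                ∑ (upTo (suc k)) (λ i → w i * (⟪ S , p (suc i) ⟫ * ⟪ T , E i ⟫)) ≡ 0ℚ * y
    vanishing S T ⟪S,p⟫≡0 y = begin
      ∑ (upTo (suc k)) (λ i → w i * (⟪ S , p (suc i) ⟫ * ⟪ T , E i ⟫))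
        ≡⟨ ∑-cong (upTo (suc k)) (λ i → trans (cong (λ a → w i * (a * ⟪ T , E i ⟫)) (⟪S,p⟫≡0 (suc i)))
                                              (trans (cong (w i *_) (ℚ.*-zeroˡ ⟪ T , E i ⟫)) (ℚ.*-zeroʳ (w i)))) ⟩
      ∑ (upTo (suc k)) (λ _ → 0ℚ)
        ≡⟨ trans (∑-zero (upTo (suc k))) (sym (ℚ.*-zeroˡ y)) ⟩
      0ℚ * y
        ∎

    newton-term : ∀ {r} S T → Positive T → S ++ T ↭ r →
      ∑ (upTo (suc k)) (λ i → w i * (⟪ S , p (suc i) ⟫ * ⟪ T , E i ⟫)) ≡ fromℕℚ (singletonValue S) * (𝟙 (sum r ℕ.≟ suc k) * χ r)
    newton-term {r} [] T _ _ = vanishing [] T ⟪[]⟫-p (𝟙 (sum r ℕ.≟ suc k) * χ r)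
    newton-term {r} (zero ∷ []) T _ _ =
      vanishing (0 ∷ []) T (λ j → trans (⟪[-]⟫-p 0 j) (ℚ.*-zeroʳ (𝟙 (j ℕ.≟ 0)))) (𝟙 (sum r ℕ.≟ suc k) * χ r)
    newton-term {r} (s ∷ s′ ∷ S) T _ _ = vanishing (s ∷ s′ ∷ S) T (⟪∷∷⟫-p s s′ S) (𝟙 (sum r ℕ.≟ suc k) * χ r)
    newton-term {r} (suc s ∷ []) T T>0 s∷T↭r = begin
      ∑ (upTo (suc k)) (λ i → w i * (⟪ suc s ∷ [] , p (suc i) ⟫ * ⟪ T , E i ⟫))
        ≡⟨ ∑-cong (upTo (suc k)) (λ i → trans (cong (λ a → w i * (a * ⟪ T , E i ⟫)) (⟪[-]⟫-p (suc s) (suc i)))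
             (solve 4 (λ w o a x → w :* ((o :* a) :* x) := o :* (a :* (w :* x))) refl (w i) (𝟙 (i ℕ.≟ s)) (fromℕℚ (suc s)) ⟪ T , E i ⟫)) ⟩
      ∑ (upTo (suc k)) (λ i → 𝟙 (i ℕ.≟ s) * (fromℕℚ (suc s) * (w i * ⟪ T , E i ⟫)))
        ≡⟨ ∑-upTo-𝟙 (suc k) s (λ i → fromℕℚ (suc s) * (w i * ⟪ T , E i ⟫)) out-of-range ⟩
      fromℕℚ (suc s) * (w s * ⟪ T , E s ⟫)
        ≡⟨ cong (λ x → fromℕℚ (suc s) * (w s * x)) (E-pairing s T T>0) ⟩
      fromℕℚ (suc s) * (w s * (𝟙 (s ℕ.+ sum T ℕ.≟ k) * χ T))
        ≡⟨ cong (fromℕℚ (suc s) *_) (ℚ*-Properties.x∙yz≈y∙xz (w s) (𝟙 (s ℕ.+ sum T ℕ.≟ k)) (χ T)) ⟩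
      fromℕℚ (suc s) * (𝟙 (s ℕ.+ sum T ℕ.≟ k) * (w s * χ T))
        ≡⟨ cong (fromℕℚ (suc s) *_) (cong₂ _*_ (𝟙-cong (s ℕ.+ sum T ℕ.≟ k) (sum r ℕ.≟ suc k)
                                                       (λ s+T≡k → trans (sym sum≡) (cong suc s+T≡k))
                                                       (λ r≡1+k → ℕ.suc-injective (trans sum≡ r≡1+k)))
                                                (trans (χ-∷ s T) (χ-↭ s∷T↭r))) ⟩
      fromℕℚ (suc s) * (𝟙 (sum r ℕ.≟ suc k) * χ r)
        ∎
      where
      sum≡ : suc (s ℕ.+ sum T) ≡ sum r
      sum≡ = sum-↭ s∷T↭r
      out-of-range : suc k ≤ s → fromℕℚ (suc s) * (w s * ⟪ T , E s ⟫) ≡ 0ℚ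
      out-of-range k<s = begin
        fromℕℚ (suc s) * (w s * ⟪ T , E s ⟫)                  ≡⟨ cong (λ x → fromℕℚ (suc s) * (w s * x)) (E-pairing s T T>0) ⟩
        fromℕℚ (suc s) * (w s * (𝟙 (s ℕ.+ sum T ℕ.≟ k) * χ T)) ≡⟨ cong (λ x → fromℕℚ (suc s) * (w s * (x * χ T)))
                                                                   (𝟙-no (s ℕ.+ sum T ℕ.≟ k) (ℕ.>⇒≢ (ℕ.<-≤-trans k<s (ℕ.m≤m+n s (sum T))))) ⟩
        fromℕℚ (suc s) * (w s * (0ℚ * χ T))                   ≡⟨ cong (λ x → fromℕℚ (suc s) * (w s * x)) (ℚ.*-zeroˡ (χ T)) ⟩
        fromℕℚ (suc s) * (w s * 0ℚ)                           ≡⟨ trans (cong (fromℕℚ (suc s) *_) (ℚ.*-zeroʳ (w s))) (ℚ.*-zeroʳ (fromℕℚ (suc s))) ⟩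
        0ℚ                                                    ∎

  ⟪⟫-newton : ∀ r → Positive r →
    ((+ 1) ℚ./ suc k) * ∑ (upTo (suc k)) (λ i → w i * ⟪ r , p (suc i) ⊗ E i ⟫) ≡ 𝟙 (sum r ℕ.≟ suc k) * χ r
  ⟪⟫-newton r r>0 = begin
    c * ∑ (upTo (suc k)) (λ i → w i * ⟪ r , p (suc i) ⊗ E i ⟫)
      ≡⟨ cong (c *_) (∑-cong (upTo (suc k)) (λ i → trans (cong (w i *_) (⟪⟫-⊗ r (p (suc i)) (E i))) (sym (∑-*ˡ (splittings r) (w i) _)))) ⟩
    c * ∑ (upTo (suc k)) (λ i → ∑ (splittings r) (λ (S , T) → w i * (⟪ S , p (suc i) ⟫ * ⟪ T , E i ⟫)))
      ≡⟨ cong (c *_) (∑-swap (upTo (suc k)) (splittings r) _) ⟩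
    c * ∑ (splittings r) (λ (S , T) → ∑ (upTo (suc k)) (λ i → w i * (⟪ S , p (suc i) ⟫ * ⟪ T , E i ⟫)))
      ≡⟨ cong (c *_) (∑-cong-All (All.zip (splittings-positive r>0 , splittings-↭ r))
                                 (λ (S , T) ((_ , T>0) , S++T↭r) → newton-term S T T>0 S++T↭r)) ⟩
    c * ∑ (splittings r) (λ (S , _) → fromℕℚ (singletonValue S) * (𝟙 (sum r ℕ.≟ suc k) * χ r))
      ≡⟨ cong (c *_) (trans (∑-*ʳ (splittings r) _ _) (cong (_* (𝟙 (sum r ℕ.≟ suc k) * χ r)) (∑-splittings-singletonValue r))) ⟩
    c * (fromℕℚ (sum r) * (𝟙 (sum r ℕ.≟ suc k) * χ r))
      ≡⟨ 1/suc-cancel k (sum r) (χ r) ⟩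
    𝟙 (sum r ℕ.≟ suc k) * χ r
      ∎
    where
    c : ℚ
    c = (+ 1) ℚ./ suc k

sign : List ℕ → ℚ
sign r = negOnePow (sum r ℕ.+ L.length r)

sign-↭ : sign Preserves _↭_ ⟶ _≡_
sign-↭ p = cong negOnePow (cong₂ ℕ._+_ (sum-↭ p) (↭-length p))

sign-∷ : ∀ k r → sign (k ∷ r) ≡ negOnePow (suc k) * sign r
sign-∷ k r = trans (cong negOnePow (regroup k (sum r) (L.length r))) (negOnePow-+ (suc k) (sum r ℕ.+ L.length r))
  where
  regroup : ∀ k s l → k ℕ.+ s ℕ.+ suc l ≡ suc k ℕ.+ (s ℕ.+ l)
  regroup = ℕ-solve-∀

⟪⟫-hList : ∀ k i r → Positive r → ⟪ r , lookupD (hList k) i ⟫ ≡ 𝟙 (i ℕ.+ sum r ℕ.≟ k)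
⟪⟫-hList zero zero r r>0 = ⟪⟫-1S r r>0
⟪⟫-hList zero (suc i) r _ = sym (𝟙-no (suc i ℕ.+ sum r ℕ.≟ 0) (λ ()))
⟪⟫-hList (suc k) (suc i) r r>0 =
  trans (⟪⟫-hList k i r r>0) (𝟙-cong (i ℕ.+ sum r ℕ.≟ k) (suc i ℕ.+ sum r ℕ.≟ suc k) (cong suc) ℕ.suc-injective)
⟪⟫-hList (suc k) zero r r>0 = begin
  ⟪ r , scale c (concatMap G (upTo (suc k))) ⟫   ≡⟨ scale-hom (⟪⟫-linear r) c (concatMap G (upTo (suc k))) ⟩
  c * ⟪ r , concatMap G (upTo (suc k)) ⟫         ≡⟨ cong (c *_) (concatMap-hom (⟪⟫-linear r) G (upTo (suc k))) ⟩
  c * ∑ (upTo (suc k)) (λ i → ⟪ r , G i ⟫)       ≡⟨ cong (c *_) (∑-cong (upTo (suc k)) (λ i → sym (ℚ.*-identityˡ ⟪ r , G i ⟫))) ⟩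
  c * ∑ (upTo (suc k)) (λ i → 1ℚ * ⟪ r , G i ⟫)  ≡⟨ ⟪⟫-newton (λ _ → 1ℚ) (λ _ → 1ℚ) (λ _ → refl) (λ _ _ → ℚ.*-identityˡ 1ℚ)
                                                                (lookupD (hList k)) k IH r r>0 ⟩
  𝟙 (sum r ℕ.≟ suc k) * 1ℚ                       ≡⟨ ℚ.*-identityʳ _ ⟩
  𝟙 (sum r ℕ.≟ suc k)                            ∎
  where
  c : ℚ
  c = (+ 1) ℚ./ suc k
  G : ℕ → Sym
  G i = p (suc i) ⊗ lookupD (hList k) i
  IH : ∀ s T → Positive T → ⟪ T , lookupD (hList k) s ⟫ ≡ 𝟙 (s ℕ.+ sum T ℕ.≟ k) * 1ℚ
  IH s T T>0 = trans (⟪⟫-hList k s T T>0) (sym (ℚ.*-identityʳ _))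

⟪⟫-eList : ∀ k i r → Positive r → ⟪ r , lookupD (eList k) i ⟫ ≡ 𝟙 (i ℕ.+ sum r ℕ.≟ k) * sign r
⟪⟫-eList zero zero [] _ = refl
⟪⟫-eList zero zero (k ∷ r) k∷r>0@(0<k ∷ _) = begin
  ⟪ k ∷ r , 1S ⟫                          ≡⟨ ⟪⟫-1S (k ∷ r) k∷r>0 ⟩
  𝟙 (sum (k ∷ r) ℕ.≟ 0)                   ≡⟨ 𝟙-no (sum (k ∷ r) ℕ.≟ 0) k+r≢0 ⟩
  0ℚ                                      ≡⟨ trans (cong (_* sign (k ∷ r)) (𝟙-no (sum (k ∷ r) ℕ.≟ 0) k+r≢0)) (ℚ.*-zeroˡ (sign (k ∷ r))) ⟨
  𝟙 (sum (k ∷ r) ℕ.≟ 0) * sign (k ∷ r)    ∎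
  where
  k+r≢0 : sum (k ∷ r) ≢ 0
  k+r≢0 = ℕ.>⇒≢ (ℕ.<-≤-trans 0<k (ℕ.m≤m+n k (sum r)))
⟪⟫-eList zero (suc i) r _ = sym (trans (cong (_* sign r) (𝟙-no (suc i ℕ.+ sum r ℕ.≟ 0) (λ ()))) (ℚ.*-zeroˡ (sign r)))
⟪⟫-eList (suc k) (suc i) r r>0 =
  trans (⟪⟫-eList k i r r>0) (cong (_* sign r) (𝟙-cong (i ℕ.+ sum r ℕ.≟ k) (suc i ℕ.+ sum r ℕ.≟ suc k) (cong suc) ℕ.suc-injective))
⟪⟫-eList (suc k) zero r r>0 = begin
  ⟪ r , scale c (concatMap G (upTo (suc k))) ⟫                     ≡⟨ scale-hom (⟪⟫-linear r) c (concatMap G (upTo (suc k))) ⟩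
  c * ⟪ r , concatMap G (upTo (suc k)) ⟫                           ≡⟨ cong (c *_) (concatMap-hom (⟪⟫-linear r) G (upTo (suc k))) ⟩
  c * ∑ (upTo (suc k)) (λ i → ⟪ r , G i ⟫)                         ≡⟨ cong (c *_) (∑-cong (upTo (suc k)) (λ i → scale-hom (⟪⟫-linear r) (negOnePow i) (p (suc i) ⊗ lookupD (eList k) i))) ⟩
  c * ∑ (upTo (suc k)) (λ i → negOnePow i * ⟪ r , p (suc i) ⊗ lookupD (eList k) i ⟫)
                                                                   ≡⟨ ⟪⟫-newton negOnePow sign sign-↭ χ-∷ (lookupD (eList k)) k (⟪⟫-eList k) r r>0 ⟩
  𝟙 (sum r ℕ.≟ suc k) * sign r                                     ∎
  where
  c : ℚ
  c = (+ 1) ℚ./ suc k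
  G : ℕ → Sym
  G i = scale (negOnePow i) (p (suc i) ⊗ lookupD (eList k) i)
  χ-∷ : ∀ s T → negOnePow s * sign T ≡ sign (suc s ∷ T)
  χ-∷ s T = trans (cong (_* sign T) (sym (negOnePow-2+ s))) (sym (sign-∷ (suc s) T))

eℤ : ℤ → Sym
eℤ (+ n) = e n
eℤ -[1+ n ] = 0S

⟪⟫-hℤ : ∀ z r → Positive r → ⟪ r , hℤ z ⟫ ≡ 𝟙 (+ sum r ℤ.≟ z)
⟪⟫-hℤ (+ n) r r>0 = trans (⟪⟫-hList n 0 r r>0) (𝟙-cong (sum r ℕ.≟ n) (+ sum r ℤ.≟ + n) (cong (λ n → + n)) ℤ.+-injective)
⟪⟫-hℤ -[1+ n ] r _ = sym (𝟙-no (+ sum r ℤ.≟ -[1+ n ]) (λ ()))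

⟪⟫-eℤ : ∀ z r → Positive r → ⟪ r , eℤ z ⟫ ≡ 𝟙 (+ sum r ℤ.≟ z) * sign r
⟪⟫-eℤ (+ n) r r>0 =
  trans (⟪⟫-eList n 0 r r>0) (cong (_* sign r) (𝟙-cong (sum r ℕ.≟ n) (+ sum r ℤ.≟ + n) (cong (λ n → + n)) ℤ.+-injective))
⟪⟫-eℤ -[1+ n ] r _ = sym (trans (cong (_* sign r) (𝟙-no (+ sum r ℤ.≟ -[1+ n ]) (λ ()))) (ℚ.*-zeroˡ (sign r)))

∂-hℤ : ∀ k z → 0 ℕ.< k → ∂ k (hℤ z) ≋ scale 1ℚ (hℤ (z - + k))
∂-hℤ k z 0<k .⟪⟫-≡ r r>0 = begin
  ⟪ r , ∂ k (hℤ z) ⟫                  ≡⟨ ⟪⟫-∂ k r (hℤ z) ⟩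
  ⟪ k ∷ r , hℤ z ⟫                    ≡⟨ ⟪⟫-hℤ z (k ∷ r) (0<k ∷ r>0) ⟩
  𝟙 (+ (k ℕ.+ sum r) ℤ.≟ z)           ≡⟨ 𝟙-cong (+ (k ℕ.+ sum r) ℤ.≟ z) (+ sum r ℤ.≟ z - + k)
                                            (+[k+s]≡z⇒+s≡z-k k (sum r) z) (+s≡z-k⇒+[k+s]≡z k (sum r) z) ⟩
  𝟙 (+ sum r ℤ.≟ z - + k)             ≡⟨ ⟪⟫-hℤ (z - + k) r r>0 ⟨
  ⟪ r , hℤ (z - + k) ⟫                ≡⟨ ℚ.*-identityˡ _ ⟨
  1ℚ * ⟪ r , hℤ (z - + k) ⟫           ≡⟨ scale-hom (⟪⟫-linear r) 1ℚ (hℤ (z - + k)) ⟨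
  ⟪ r , scale 1ℚ (hℤ (z - + k)) ⟫     ∎

∂-eℤ : ∀ k z → 0 ℕ.< k → ∂ k (eℤ z) ≋ scale (negOnePow (suc k)) (eℤ (z - + k))
∂-eℤ k z 0<k .⟪⟫-≡ r r>0 = begin
  ⟪ r , ∂ k (eℤ z) ⟫                                          ≡⟨ ⟪⟫-∂ k r (eℤ z) ⟩
  ⟪ k ∷ r , eℤ z ⟫                                            ≡⟨ ⟪⟫-eℤ z (k ∷ r) (0<k ∷ r>0) ⟩
  𝟙 (+ (k ℕ.+ sum r) ℤ.≟ z) * sign (k ∷ r)                    ≡⟨ cong₂ _*_ (𝟙-cong (+ (k ℕ.+ sum r) ℤ.≟ z) (+ sum r ℤ.≟ z - + k)
                                                                          (+[k+s]≡z⇒+s≡z-k k (sum r) z) (+s≡z-k⇒+[k+s]≡z k (sum r) z))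
                                                                   (sign-∷ k r) ⟩
  𝟙 (+ sum r ℤ.≟ z - + k) * (negOnePow (suc k) * sign r)      ≡⟨ ℚ*-Properties.x∙yz≈y∙xz (𝟙 (+ sum r ℤ.≟ z - + k)) (negOnePow (suc k)) (sign r) ⟩
  negOnePow (suc k) * (𝟙 (+ sum r ℤ.≟ z - + k) * sign r)      ≡⟨ cong (negOnePow (suc k) *_) (⟪⟫-eℤ (z - + k) r r>0) ⟨
  negOnePow (suc k) * ⟪ r , eℤ (z - + k) ⟫                    ≡⟨ scale-hom (⟪⟫-linear r) (negOnePow (suc k)) (eℤ (z - + k)) ⟨
  ⟪ r , scale (negOnePow (suc k)) (eℤ (z - + k)) ⟫            ∎

-- The recurrence for ⟨p_μ, h_N h_λ e_τ⟩

∏ˢ : ∀ {n} → (ℤ → Sym) → Vec ℤ n → Sym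
∏ˢ F [] = 1S
∏ˢ F (z ∷ zs) = F z ⊗ ∏ˢ F zs

lowerAt : ∀ {n} → Vec ℤ n → Fin n → ℕ → Vec ℤ n
lowerAt v i k = V.updateAt v i (_- + k)

∂-∏ˢ : ∀ k F c → (∀ z → ∂ k (F z) ≋ scale c (F (z - + k))) →
       ∀ {n} (v : Vec ℤ n) → ∂ k (∏ˢ F v) ≋ concatMap (λ i → scale c (∏ˢ F (lowerAt v i k))) (allFin n)
∂-∏ˢ k F c ∂F [] .⟪⟫-≡ r r>0 = refl
∂-∏ˢ k F c ∂F {suc n} (z ∷ zs) .⟪⟫-≡ r r>0 = begin
  ⟪ r , ∂ k (F z ⊗ ∏ˢ F zs) ⟫
    ≡⟨ ⟪⟫-∂ k r (F z ⊗ ∏ˢ F zs) ⟩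
  ⟪ k ∷ r , F z ⊗ ∏ˢ F zs ⟫
    ≡⟨ ⟪∷⟫-⊗ k r (F z) (∏ˢ F zs) ⟩
  ⟪ r , ∂ k (F z) ⊗ ∏ˢ F zs ⟫ + ⟪ r , F z ⊗ ∂ k (∏ˢ F zs) ⟫
    ≡⟨ cong₂ _+_ (⊗-congˡ (∂F z) (∏ˢ F zs) .⟪⟫-≡ r r>0) (⊗-congʳ (F z) (∂-∏ˢ k F c ∂F zs) .⟪⟫-≡ r r>0) ⟩
  ⟪ r , scale c (F (z - + k)) ⊗ ∏ˢ F zs ⟫ + ⟪ r , F z ⊗ concatMap (λ i → scale c (∏ˢ F (lowerAt zs i k))) (allFin n) ⟫
    ≡⟨ cong₂ _+_ (scale-hom (⊗-linearˡ r (∏ˢ F zs)) c (F (z - + k)))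
                 (concatMap-scale-hom (⊗-linearʳ r (F z) id ⟪⟫-linear) c (λ i → ∏ˢ F (lowerAt zs i k)) (allFin n)) ⟩
  c * ⟪ r , F (z - + k) ⊗ ∏ˢ F zs ⟫ + ∑ (allFin n) (λ i → c * ⟪ r , F z ⊗ ∏ˢ F (lowerAt zs i k) ⟫)
    ≡⟨ ∑-allFin-suc n (λ i → c * ⟪ r , ∏ˢ F (lowerAt (z ∷ zs) i k) ⟫) ⟨
  ∑ (allFin (suc n)) (λ i → c * ⟪ r , ∏ˢ F (lowerAt (z ∷ zs) i k) ⟫)
    ≡⟨ concatMap-scale-hom (⟪⟫-linear r) c (λ i → ∏ˢ F (lowerAt (z ∷ zs) i k)) (allFin (suc n)) ⟨
  ⟪ r , concatMap (λ i → scale c (∏ˢ F (lowerAt (z ∷ zs) i k))) (allFin (suc n)) ⟫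
    ∎

hProd eProd : ∀ {n} → Vec ℤ n → Sym
hProd = ∏ˢ hℤ
eProd = ∏ˢ eℤ

hheProd : ∀ {a b} → ℤ → Vec ℤ a → Vec ℤ b → Sym
hheProd N la ta = hℤ N ⊗ (hProd la ⊗ eProd ta)

⟪∷⟫-hheProd : ∀ k r → Positive (k ∷ r) → ∀ N {a b} (la : Vec ℤ a) (ta : Vec ℤ b) →
  ⟪ k ∷ r , hheProd N la ta ⟫ ≡
    ⟪ r , hheProd (N - + k) la ta ⟫
    + (∑ (allFin a) (λ i → ⟪ r , hheProd N (lowerAt la i k) ta ⟫)
       + ∑ (allFin b) (λ j → negOnePow (suc k) * ⟪ r , hheProd N la (lowerAt ta j k) ⟫))
⟪∷⟫-hheProd k r (0<k ∷ r>0) N {a} {b} la ta = begin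
  ⟪ k ∷ r , hℤ N ⊗ (H ⊗ E) ⟫
    ≡⟨ ⟪∷⟫-⊗ k r (hℤ N) (H ⊗ E) ⟩
  ⟪ r , ∂ k (hℤ N) ⊗ (H ⊗ E) ⟫ + ⟪ r , hℤ N ⊗ ∂ k (H ⊗ E) ⟫
    ≡⟨ cong₂ _+_ (⊗-congˡ (∂-hℤ k N 0<k) (H ⊗ E) .⟪⟫-≡ r r>0)
                 (⊗-congʳ (hℤ N) (∂-⊗ k {H} {g = E} (∂-∏ˢ k hℤ 1ℚ (λ z → ∂-hℤ k z 0<k) la) (∂-∏ˢ k eℤ c (λ z → ∂-eℤ k z 0<k) ta)) .⟪⟫-≡ r r>0) ⟩
  ⟪ r , scale 1ℚ (hℤ (N - + k)) ⊗ (H ⊗ E) ⟫ + ⟪ r , hℤ N ⊗ ((H′ ⊗ E) ++ (H ⊗ E′)) ⟫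
    ≡⟨ cong₂ _+_ (trans (scale-hom (⊗-linearˡ r (H ⊗ E)) 1ℚ (hℤ (N - + k))) (ℚ.*-identityˡ ⟪ r , hheProd (N - + k) la ta ⟫))
                 (++-hom (⊗-linearʳ r (hℤ N) id ⟪⟫-linear) (H′ ⊗ E) (H ⊗ E′)) ⟩
  ⟪ r , hheProd (N - + k) la ta ⟫ + (⟪ r , hℤ N ⊗ (H′ ⊗ E) ⟫ + ⟪ r , hℤ N ⊗ (H ⊗ E′) ⟫)
    ≡⟨ cong (_+_ ⟪ r , hheProd (N - + k) la ta ⟫) (cong₂ _+_
         (trans (concatMap-scale-hom (⊗-linearʳ r (hℤ N) (_⊗ E) (λ T → ⊗-linearˡ T E)) 1ℚ (λ i → hProd (lowerAt la i k)) (allFin a))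
                (∑-cong (allFin a) (λ i → ℚ.*-identityˡ ⟪ r , hheProd N (lowerAt la i k) ta ⟫)))
         (concatMap-scale-hom (⊗-linearʳ r (hℤ N) (H ⊗_) (λ T → ⊗-linearʳ T H id ⟪⟫-linear)) c (λ j → eProd (lowerAt ta j k)) (allFin b))) ⟩
  ⟪ r , hheProd (N - + k) la ta ⟫
  + (∑ (allFin a) (λ i → ⟪ r , hheProd N (lowerAt la i k) ta ⟫) + ∑ (allFin b) (λ j → c * ⟪ r , hheProd N la (lowerAt ta j k) ⟫))
    ∎
  where
  c : ℚ
  c = negOnePow (suc k)
  H E H′ E′ : Sym
  H = hProd la
  E = eProd ta
  H′ = concatMap (λ i → scale 1ℚ (hProd (lowerAt la i k))) (allFin a)
  E′ = concatMap (λ j → scale c (eProd (lowerAt ta j k))) (allFin b)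

-- The recurrence for signed fillings

Matches : ∀ {n} → Vec ℤ n → (Fin n → ℕ) → Set
Matches v c = ∀ i → + c i ≡ V.lookup v i

matches? : ∀ {n} (v : Vec ℤ n) c → Dec (Matches v c)
matches? v c = all? (λ i → + c i ℤ.≟ V.lookup v i)

module _ {n} (v : Vec ℤ n) (i₀ : Fin n) (k : ℕ) (c : Fin n → ℕ) where

  private
    bumped : Fin n → ℕ
    bumped i = (if ⌊ i Fin.≟ i₀ ⌋ then k else 0) ℕ.+ c i

  Matches-lowerAt⁺ : Matches v bumped → Matches (lowerAt v i₀ k) c
  Matches-lowerAt⁺ match i with i Fin.≟ i₀ | match i
  ... | yes refl | k+c≡v = trans (+[k+s]≡z⇒+s≡z-k k (c i) _ k+c≡v) (sym (lookup∘updateAt i v))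
  ... | no i≢i₀ | c≡v = trans c≡v (sym (lookup∘updateAt′ i i₀ i≢i₀ v))

  Matches-lowerAt⁻ : Matches (lowerAt v i₀ k) c → Matches v bumped
  Matches-lowerAt⁻ match i with i Fin.≟ i₀ | match i
  ... | yes refl | c≡v-k = +s≡z-k⇒+[k+s]≡z k (c i) _ (trans c≡v-k (lookup∘updateAt i v))
  ... | no i≢i₀ | c≡v = trans c≡v (lookup∘updateAt′ i i₀ i≢i₀ v)

Fits : ∀ {a b} → Vec ℤ a → Vec ℤ b → (r : List ℕ) → Vec (Label a b) (L.length r) → Set
Fits la ta r F = Matches la (λ i → cellsWith (isU i) (V.fromList r) F) × Matches ta (λ j → cellsWith (isP j) (V.fromList r) F)

fits? : ∀ {a b} (la : Vec ℤ a) (ta : Vec ℤ b) r F → Dec (Fits la ta r F)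
fits? la ta r F = matches? la _ ×-dec matches? ta _

weight : ∀ {a b} r → Vec (Label a b) (L.length r) → ℚ
weight r F = negOnePow (cellsWith isPrimed (V.fromList r) F ℕ.+ rowsWith isPrimed F)

-- No filling fits a vector with a negative entry.
signedFillings : ∀ {a b} → Vec ℤ a → Vec ℤ b → List ℕ → ℚ
signedFillings {a} {b} la ta r = ∑ (allVecs (allLabels a b) (L.length r)) (λ F → 𝟙 (fits? la ta r F) * weight r F)

∑-allLabels : ∀ a b (G : Label a b → ℚ) →
  ∑ (allLabels a b) G ≡ G nothing + (∑ (allFin a) (λ i → G (just (inj₁ i))) + ∑ (allFin b) (λ j → G (just (inj₂ j))))
∑-allLabels a b G = cong (_+_ (G nothing)) (trans (∑-++ (map (just ∘ inj₁) (allFin a)) _ G)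
  (cong₂ _+_ (∑-map (just ∘ inj₁) (allFin a) G) (∑-map (just ∘ inj₂) (allFin b) G)))

-- An empty first row changes neither the label counts nor the weight, hence the first summand.
signedFillings-∷ : ∀ k r {a b} (la : Vec ℤ a) (ta : Vec ℤ b) →
  signedFillings la ta (k ∷ r) ≡
    signedFillings la ta r
    + (∑ (allFin a) (λ i → signedFillings (lowerAt la i k) ta r)
       + ∑ (allFin b) (λ j → negOnePow (suc k) * signedFillings la (lowerAt ta j k) r))
signedFillings-∷ k r {a} {b} la ta = begin
  ∑ (allVecs (allLabels a b) (suc (L.length r))) G
    ≡⟨ ∑-allVecs-suc (allLabels a b) (L.length r) G ⟩
  ∑ (allLabels a b) (λ x → ∑ Fs (λ F → G (x ∷ F)))
    ≡⟨ ∑-allLabels a b (λ x → ∑ Fs (λ F → G (x ∷ F))) ⟩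
  ∑ Fs (λ F → G (nothing ∷ F))
  + (∑ (allFin a) (λ i → ∑ Fs (λ F → G (just (inj₁ i) ∷ F))) + ∑ (allFin b) (λ j → ∑ Fs (λ F → G (just (inj₂ j) ∷ F))))
    ≡⟨ cong (_+_ (signedFillings la ta r)) (cong₂ _+_
         (∑-cong (allFin a) (λ i → ∑-cong Fs (unprimed-first-row i)))
         (∑-cong (allFin b) (λ j → trans (∑-cong Fs (primed-first-row j)) (∑-*ˡ Fs (negOnePow (suc k)) _)))) ⟩
  signedFillings la ta r
  + (∑ (allFin a) (λ i → signedFillings (lowerAt la i k) ta r) + ∑ (allFin b) (λ j → negOnePow (suc k) * signedFillings la (lowerAt ta j k) r))
    ∎
  where
  Fs : List (Vec (Label a b) (L.length r))
  Fs = allVecs (allLabels a b) (L.length r)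
  G : Vec (Label a b) (L.length (k ∷ r)) → ℚ
  G F = 𝟙 (fits? la ta (k ∷ r) F) * weight (k ∷ r) F
  unprimed-first-row : ∀ i F → G (just (inj₁ i) ∷ F) ≡ 𝟙 (fits? (lowerAt la i k) ta r F) * weight r F
  unprimed-first-row i F = cong (_* weight r F)
    (𝟙-cong (fits? la ta (k ∷ r) (just (inj₁ i) ∷ F)) (fits? (lowerAt la i k) ta r F)
            (map₁ (Matches-lowerAt⁺ la i k _)) (map₁ (Matches-lowerAt⁻ la i k _)))
  primed-first-row : ∀ j F → G (just (inj₂ j) ∷ F) ≡ negOnePow (suc k) * (𝟙 (fits? la (lowerAt ta j k) r F) * weight r F)
  primed-first-row j F = begin
    G (just (inj₂ j) ∷ F)
      ≡⟨ cong₂ _*_ (𝟙-cong (fits? la ta (k ∷ r) (just (inj₂ j) ∷ F)) (fits? la (lowerAt ta j k) r F)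
                           (map₂ (Matches-lowerAt⁺ ta j k _)) (map₂ (Matches-lowerAt⁻ ta j k _)))
                   (trans (cong negOnePow (regroup k (cellsWith isPrimed (V.fromList r) F) (rowsWith isPrimed F)))
                          (negOnePow-+ (suc k) _)) ⟩
    𝟙 (fits? la (lowerAt ta j k) r F) * (negOnePow (suc k) * weight r F)
      ≡⟨ ℚ*-Properties.x∙yz≈y∙xz (𝟙 (fits? la (lowerAt ta j k) r F)) (negOnePow (suc k)) (weight r F) ⟩
    negOnePow (suc k) * (𝟙 (fits? la (lowerAt ta j k) r F) * weight r F)
      ∎
    where
    regroup : ∀ k c w → k ℕ.+ c ℕ.+ suc w ≡ suc k ℕ.+ (c ℕ.+ w)
    regroup = ℕ-solve-∀

⟪[]⟫-∏ˢ : ∀ F → (∀ z → ⟪ [] , F z ⟫ ≡ 𝟙 (+ 0 ℤ.≟ z)) → ∀ {n} (v : Vec ℤ n) → ⟪ [] , ∏ˢ F v ⟫ ≡ 𝟙 (matches? v (λ _ → 0))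
⟪[]⟫-∏ˢ F ⟪[]⟫-F [] = sym (𝟙-yes (matches? [] (λ _ → 0)) (λ ()))
⟪[]⟫-∏ˢ F ⟪[]⟫-F (z ∷ zs) = begin
  ⟪ [] , F z ⊗ ∏ˢ F zs ⟫                                ≡⟨ ⟪[]⟫-⊗ (F z) (∏ˢ F zs) ⟩
  ⟪ [] , F z ⟫ * ⟪ [] , ∏ˢ F zs ⟫                       ≡⟨ cong₂ _*_ (⟪[]⟫-F z) (⟪[]⟫-∏ˢ F ⟪[]⟫-F zs) ⟩
  𝟙 (+ 0 ℤ.≟ z) * 𝟙 (matches? zs (λ _ → 0))             ≡⟨ 𝟙-×-dec (+ 0 ℤ.≟ z) (matches? zs (λ _ → 0)) ⟨
  𝟙 ((+ 0 ℤ.≟ z) ×-dec matches? zs (λ _ → 0))           ≡⟨ 𝟙-cong ((+ 0 ℤ.≟ z) ×-dec matches? zs (λ _ → 0)) (matches? (z ∷ zs) (λ _ → 0))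
                                                              (λ { (0≡z , _) Fin.zero → 0≡z ; (_ , 0≡zs) (Fin.suc i) → 0≡zs i })
                                                              (λ 0≡z∷zs → 0≡z∷zs Fin.zero , 0≡z∷zs ∘ Fin.suc) ⟩
  𝟙 (matches? (z ∷ zs) (λ _ → 0))                       ∎

vsum : ∀ {n} → Vec ℤ n → ℤ
vsum [] = + 0
vsum (z ∷ zs) = z ℤ.+ vsum zs

vsum-lowerAt : ∀ {n} (v : Vec ℤ n) i k → vsum (lowerAt v i k) ≡ vsum v - + k
vsum-lowerAt (z ∷ zs) Fin.zero k = regroup z (vsum zs) (+ k)
  where
  regroup : ∀ z s k → (z - k) ℤ.+ s ≡ (z ℤ.+ s) - k
  regroup = ℤ-solve-∀
vsum-lowerAt (z ∷ zs) (Fin.suc i) k = trans (cong (ℤ._+_ z) (vsum-lowerAt zs i k)) (regroup z (vsum zs) (+ k))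
  where
  regroup : ∀ z s k → z ℤ.+ (s - k) ≡ (z ℤ.+ s) - k
  regroup = ℤ-solve-∀

vsum-zero : ∀ {n} (v : Vec ℤ n) → Matches v (λ _ → 0) → vsum v ≡ + 0
vsum-zero [] _ = refl
vsum-zero (z ∷ zs) 0≡z∷zs = cong₂ ℤ._+_ (sym (0≡z∷zs Fin.zero)) (vsum-zero zs (0≡z∷zs ∘ Fin.suc))

⟪[]⟫-hheProd : ∀ N {a b} (la : Vec ℤ a) (ta : Vec ℤ b) → N ℤ.+ (vsum la ℤ.+ vsum ta) ≡ + 0 →
               ⟪ [] , hheProd N la ta ⟫ ≡ signedFillings la ta []
⟪[]⟫-hheProd N la ta balanced = begin
  ⟪ [] , hℤ N ⊗ (hProd la ⊗ eProd ta) ⟫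
    ≡⟨ trans (⟪[]⟫-⊗ (hℤ N) (hProd la ⊗ eProd ta)) (cong (⟪ [] , hℤ N ⟫ *_) (⟪[]⟫-⊗ (hProd la) (eProd ta))) ⟩
  ⟪ [] , hℤ N ⟫ * (⟪ [] , hProd la ⟫ * ⟪ [] , eProd ta ⟫)
    ≡⟨ cong₂ _*_ (⟪⟫-hℤ N [] []) (cong₂ _*_ (⟪[]⟫-∏ˢ hℤ (λ z → ⟪⟫-hℤ z [] []) la)
                                            (⟪[]⟫-∏ˢ eℤ (λ z → trans (⟪⟫-eℤ z [] []) (ℚ.*-identityʳ _)) ta)) ⟩
  𝟙 (+ 0 ℤ.≟ N) * (𝟙 (matches? la (λ _ → 0)) * 𝟙 (matches? ta (λ _ → 0)))
    ≡⟨ combine (+ 0 ℤ.≟ N) (matches? la (λ _ → 0)) (matches? ta (λ _ → 0)) ⟩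
  𝟙 (matches? la (λ _ → 0) ×-dec matches? ta (λ _ → 0)) * 1ℚ + 0ℚ
    ∎
  where
  N≡0 : Matches la (λ _ → 0) → Matches ta (λ _ → 0) → + 0 ≡ N
  N≡0 la≡0 ta≡0 = begin
    + 0                          ≡⟨ balanced ⟨
    N ℤ.+ (vsum la ℤ.+ vsum ta)  ≡⟨ cong₂ (λ x y → N ℤ.+ (x ℤ.+ y)) (vsum-zero la la≡0) (vsum-zero ta ta≡0) ⟩
    N ℤ.+ + 0                    ≡⟨ ℤ.+-identityʳ N ⟩
    N                            ∎
  combine : ∀ (N? : Dec (+ 0 ≡ N)) (la? : Dec (Matches la (λ _ → 0))) (ta? : Dec (Matches ta (λ _ → 0))) →
            𝟙 N? * (𝟙 la? * 𝟙 ta?) ≡ 𝟙 (la? ×-dec ta?) * 1ℚ + 0ℚ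
  combine N? (yes la≡0) (yes ta≡0) rewrite 𝟙-yes N? (N≡0 la≡0 ta≡0) = refl
  combine N? (yes _) (no _) = trans (cong (𝟙 N? *_) (ℚ.*-zeroʳ 1ℚ)) (ℚ.*-zeroʳ (𝟙 N?))
  combine N? (no _) ta? = trans (cong (𝟙 N? *_) (ℚ.*-zeroˡ (𝟙 ta?))) (ℚ.*-zeroʳ (𝟙 N?))

-- The balance N + |λ| + |τ| = |r| is only needed at r = [], to force N = 0.
⟪⟫-hheProd≡signedFillings : ∀ r → Positive r → ∀ N {a b} (la : Vec ℤ a) (ta : Vec ℤ b) →
  N ℤ.+ (vsum la ℤ.+ vsum ta) ≡ + sum r → ⟪ r , hheProd N la ta ⟫ ≡ signedFillings la ta r
⟪⟫-hheProd≡signedFillings [] _ N la ta balanced = ⟪[]⟫-hheProd N la ta balanced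
⟪⟫-hheProd≡signedFillings (k ∷ r) k∷r>0@(_ ∷ r>0) N {a} {b} la ta balanced = begin
  ⟪ k ∷ r , hheProd N la ta ⟫
    ≡⟨ ⟪∷⟫-hheProd k r k∷r>0 N la ta ⟩
  ⟪ r , hheProd (N - + k) la ta ⟫
  + (∑ (allFin a) (λ i → ⟪ r , hheProd N (lowerAt la i k) ta ⟫)
     + ∑ (allFin b) (λ j → negOnePow (suc k) * ⟪ r , hheProd N la (lowerAt ta j k) ⟫))
    ≡⟨ cong₂ _+_ (IH (N - + k) la ta balanced-h)
                 (cong₂ _+_ (∑-cong (allFin a) (λ i → IH N (lowerAt la i k) ta (balanced-la i)))
                            (∑-cong (allFin b) (λ j → cong (negOnePow (suc k) *_) (IH N la (lowerAt ta j k) (balanced-ta j))))) ⟩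
  signedFillings la ta r
  + (∑ (allFin a) (λ i → signedFillings (lowerAt la i k) ta r)
     + ∑ (allFin b) (λ j → negOnePow (suc k) * signedFillings la (lowerAt ta j k) r))
    ≡⟨ signedFillings-∷ k r la ta ⟨
  signedFillings la ta (k ∷ r)
    ∎
  where
  IH : ∀ N {a b} (la : Vec ℤ a) (ta : Vec ℤ b) →
       N ℤ.+ (vsum la ℤ.+ vsum ta) ≡ + sum r → ⟪ r , hheProd N la ta ⟫ ≡ signedFillings la ta r
  IH = ⟪⟫-hheProd≡signedFillings r r>0
  Σa Σb : ℤ
  Σa = vsum la
  Σb = vsum ta
  r≡N+Σ-k : + sum r ≡ N ℤ.+ (Σa ℤ.+ Σb) - + k
  r≡N+Σ-k = +[k+s]≡z⇒+s≡z-k k (sum r) _ (sym balanced)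
  balanced-h : (N - + k) ℤ.+ (Σa ℤ.+ Σb) ≡ + sum r
  balanced-h = trans (regroup N Σa Σb (+ k)) (sym r≡N+Σ-k)
    where
    regroup : ∀ n x y k → (n - k) ℤ.+ (x ℤ.+ y) ≡ n ℤ.+ (x ℤ.+ y) - k
    regroup = ℤ-solve-∀
  balanced-la : ∀ i → N ℤ.+ (vsum (lowerAt la i k) ℤ.+ Σb) ≡ + sum r
  balanced-la i = trans (cong (λ x → N ℤ.+ (x ℤ.+ Σb)) (vsum-lowerAt la i k)) (trans (regroup N Σa Σb (+ k)) (sym r≡N+Σ-k))
    where
    regroup : ∀ n x y k → n ℤ.+ ((x - k) ℤ.+ y) ≡ n ℤ.+ (x ℤ.+ y) - k
    regroup = ℤ-solve-∀
  balanced-ta : ∀ j → N ℤ.+ (Σa ℤ.+ vsum (lowerAt ta j k)) ≡ + sum r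
  balanced-ta j = trans (cong (λ y → N ℤ.+ (Σa ℤ.+ y)) (vsum-lowerAt ta j k)) (trans (regroup N Σa Σb (+ k)) (sym r≡N+Σ-k))
    where
    regroup : ∀ n x y k → n ℤ.+ (x ℤ.+ (y - k)) ≡ n ℤ.+ (x ℤ.+ y) - k
    regroup = ℤ-solve-∀

ints : (xs : List ℕ) → Vec ℤ (L.length xs)
ints xs = V.map +_ (V.fromList xs)

vsum-ints : ∀ xs → vsum (ints xs) ≡ + sum xs
vsum-ints [] = refl
vsum-ints (x ∷ xs) = trans (cong (ℤ._+_ (+ x)) (vsum-ints xs)) (sym (ℤ.pos-+ x (sum xs)))

hPart≡hProd : ∀ λ′ → hPart λ′ ≡ hProd (ints λ′)
hPart≡hProd [] = refl
hPart≡hProd (x ∷ λ′) = cong (h x ⊗_) (hPart≡hProd λ′)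

ePart≡eProd : ∀ τ → ePart τ ≡ eProd (ints τ)
ePart≡eProd [] = refl
ePart≡eProd (x ∷ τ) = cong (e x ⊗_) (ePart≡eProd τ)

module _ (xs : List ℕ) (c : Fin (L.length xs) → ℕ) where

  Matches-ints⁺ : (∀ i → c i ≡ V.lookup (V.fromList xs) i) → Matches (ints xs) c
  Matches-ints⁺ c≡xs i = trans (cong (λ n → + n) (c≡xs i)) (sym (lookup-map i +_ (V.fromList xs)))

  Matches-ints⁻ : Matches (ints xs) c → ∀ i → c i ≡ V.lookup (V.fromList xs) i
  Matches-ints⁻ c≡xs i = ℤ.+-injective (trans (c≡xs i) (lookup-map i +_ (V.fromList xs)))

fillings≡signedFillings : ∀ λ′ τ μ → sumℚ (map (wt λ′ τ μ) (fillings λ′ τ μ)) ≡ signedFillings (ints λ′) (ints τ) μ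
fillings≡signedFillings λ′ τ μ =
  trans (∑-filter (valid? λ′ τ μ) Fs (wt λ′ τ μ)) (∑-cong Fs λ F → cong (_* wt λ′ τ μ F)
    (𝟙-cong (valid? λ′ τ μ F) (fits? (ints λ′) (ints τ) μ F)
            (Product.map (Matches-ints⁺ λ′ _) (Matches-ints⁺ τ _))
            (Product.map (Matches-ints⁻ λ′ _) (Matches-ints⁻ τ _))))
  where
  Fs : List (Filling λ′ τ μ)
  Fs = allVecs (allLabels (L.length λ′) (L.length τ)) (L.length μ)

proposition43 : (la ta mu : List ℕ) → IsPartition la → IsPartition ta → IsPartition mu →
    ⟨ pPart mu , hℤ ((+ ∣ mu ∣ - + ∣ la ∣) - + ∣ ta ∣) ⊗ (hPart la ⊗ ePart ta) ⟩
      ≡ sumℚ (map (wt la ta mu) (fillings la ta mu))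
proposition43 la ta mu _ _ (mu>0 , mu↘) = begin
  ⟨ pPart mu , hℤ N ⊗ (hPart la ⊗ ePart ta) ⟩
    ≡⟨ ⟨pPart,⟩≡⟪,⟫ mu>0 mu↘ (⊗-decreasing (hℤ N) (⊗-decreasing (hPart la) (ePart-decreasing ta))) ⟩
  ⟪ mu , hℤ N ⊗ (hPart la ⊗ ePart ta) ⟫
    ≡⟨ cong (λ X → ⟪ mu , hℤ N ⊗ X ⟫) (cong₂ _⊗_ (hPart≡hProd la) (ePart≡eProd ta)) ⟩
  ⟪ mu , hheProd N (ints la) (ints ta) ⟫
    ≡⟨ ⟪⟫-hheProd≡signedFillings mu mu>0 N (ints la) (ints ta) balanced ⟩
  signedFillings (ints la) (ints ta) mu
    ≡⟨ fillings≡signedFillings la ta mu ⟨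
  sumℚ (map (wt la ta mu) (fillings la ta mu))
    ∎
  where
  N : ℤ
  N = (+ ∣ mu ∣ - + ∣ la ∣) - + ∣ ta ∣
  balanced : N ℤ.+ (vsum (ints la) ℤ.+ vsum (ints ta)) ≡ + sum mu
  balanced = trans (cong₂ (λ x y → N ℤ.+ (x ℤ.+ y)) (vsum-ints la) (vsum-ints ta)) (cancel (+ sum mu) (+ sum la) (+ sum ta))
    where
    cancel : ∀ m l t → ((m - l) - t) ℤ.+ (l ℤ.+ t) ≡ m
    cancel = ℤ-solve-∀
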